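{- Let $s\geq 1$ and $k,r\geq 2$ be integers. Then there exists $n_0(k,s,r)$ such that for all $n>n_0(k,s,r)$ the following holds: if $\mathcal{H}$ is a shifted $r$-uniform hypergraph on $[n]$ with $\nu(\mathcal{H})<s$, then $$N\big(S_{r-1,k}^r,\mathcal{H}\big)\leq N\Big(S_{r-1,k}^r,\binom{[n]}{r}-\binom{[s,n]}{r}\Big),$$ with equality if and only if $\mathcal{H}=\binom{[n]}{r}-\binom{[s,n]}{r}$.
   Context: An $r$-uniform hypergraph is identified with its set of hyperedges ($r$-subsets of the vertex set). $\binom{V}{r}$ is the family of all $r$-subsets of $V$ and $[m,n]=\{m,\dots,n\}$, so $\binom{[n]}{r}-\binom{[s,n]}{r}$ is the family of all $r$-subsets of $[n]$ intersecting $[s-1]$. $\nu(\mathcal{H})$ is the maximum number of pairwise disjoint hyperedges. For $1\le i<j\le n$ and a hyperedge $e$, $S_{ij}(e)=(e\setminus\{j\})\cup\{i\}$ if $j\in e$, $i\notin e$ and $(e\setminus\{j\})\cup\{i\}\notin\mathcal{H}$, and $S_{ij}(e)=e$ otherwise; $S_{ij}(\mathcal{H})=\{S_{ij}(e):e\in\mathcal{H}\}$. $\mathcal{H}$ is shifted if $S_{ij}(\mathcal{H})=\mathcal{H}$ for all $1\le i<j\le n$. $S_{r-1,k}^r$ is the $r$-uniform hypergraph with hyperedges $e_1,\dots,e_k$ such that there is an $(r-1)$-set $T$ with $e_a\cap e_b=T$ for all $1\le a<b\le k$. $N(\mathcal{F},\mathcal{G})$ is the number of subhypergraphs of $\mathcal{G}$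 isomorphic to $\mathcal{F}$. -}

module Defs where

open import Data.Nat using (ℕ; zero; suc; _∸_; _<_; _≡ᵇ_; _<ᵇ_)
open import Data.Bool using (Bool; true; false; _∧_; _∨_; not; if_then_else_)
open import Data.Fin using (Fin; toℕ)
import Data.Fin as F
open import Data.Fin.Subset using (Subset; ∣_∣; _∩_; ⊥; inside; outside)
open import Data.Vec using (Vec; []; _∷_; lookup; _[_]≔_)
open import Data.List using (List; []; _∷_; map; _++_; filter; length)
open import Data.Bool.ListAction using (all; any)
open import Data.Product using (Σ; _×_; ∃-syntax)
open import Relation.Binary.PropositionalEquality using (_≡_; _≢_)
open import Relation.Nullary using (¬_)
open import Function.Bundles using (_⇔_)

-- Vertices of [n] are Fin n (vertex i of Fin n is the integer toℕ i + 1).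
Hypergraph : ℕ → Set
Hypergraph n = Subset n → Bool

_≐_ : ∀ {n} → Hypergraph n → Hypergraph n → Set
H ≐ G = ∀ e → H e ≡ G e

Uniform : ∀ {n} → ℕ → Hypergraph n → Set
Uniform r H = ∀ e → H e ≡ true → ∣ e ∣ ≡ r

_==ˢ_ : ∀ {n} → Subset n → Subset n → Bool
[] ==ˢ [] = true
(true ∷ xs) ==ˢ (true ∷ ys) = xs ==ˢ ys
(false ∷ xs) ==ˢ (false ∷ ys) = xs ==ˢ ys
(true ∷ xs) ==ˢ (false ∷ ys) = false
(false ∷ xs) ==ˢ (true ∷ ys) = false

allSubsets : ∀ n → List (Subset n)
allSubsets zero = [] ∷ []
allSubsets (suc n) = map (true ∷_) (allSubsets n) ++ map (false ∷_) (allSubsets n)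

HasDisjointEdges : ∀ {n} → Hypergraph n → ℕ → Set
HasDisjointEdges {n} H s =
  Σ (Fin s → Subset n) λ es →
    (∀ i → H (es i) ≡ true) × (∀ i j → i ≢ j → es i ∩ es j ≡ ⊥)

νLessThan : ∀ {n} → Hypergraph n → ℕ → Set
νLessThan H s = ¬ HasDisjointEdges H s

shiftEdge : ∀ {n} → Fin n → Fin n → Hypergraph n → Subset n → Subset n
shiftEdge i j H e =
  let e' = (e [ j ]≔ outside) [ i ]≔ inside in
  if lookup e j ∧ not (lookup e i) ∧ not (H e') then e' else e

InShift : ∀ {n} → Fin n → Fin n → Hypergraph n → Subset n → Set
InShift i j H f = ∃[ e ] (H e ≡ true × shiftEdge i j H e ≡ f)

Shifted : ∀ {n} → Hypergraph n → Set
Shifted H = ∀ i j → i F.< j → ∀ f → (InShift i j H f ⇔ (H f ≡ true))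

combinations : ∀ {A : Set} → ℕ → List A → List (List A)
combinations zero _ = [] ∷ []
combinations (suc k) [] = []
combinations (suc k) (x ∷ xs) =
  map (x ∷_) (combinations k xs) ++ combinations (suc k) xs

allPairs : ∀ {A : Set} → (A → A → Bool) → List A → Bool
allPairs p [] = true
allPairs p (x ∷ xs) = all (p x) xs ∧ allPairs p xs

edges : ∀ {n} → Hypergraph n → List (Subset n)
edges {n} H = filter (λ e → H e Data.Bool.≟ true) (allSubsets n)
  where import Data.Bool

-- a family of edges is a copy of S^r_{r-1,k} (size checked separately):
-- there is an (r-1)-set T with e_a ∩ e_b = T for all a ≠ b
isStar : ∀ {n} → ℕ → List (Subset n) → Bool
isStar {n} r es =
  any (λ T → (∣ T ∣ ≡ᵇ (r ∸ 1)) ∧ allPairs (λ a b → (a ∩ b) ==ˢ T) es)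
      (allSubsets n)

NStar : ∀ {n} → ℕ → ℕ → Hypergraph n → ℕ
NStar k r H = length (filter (λ es → isStar r es Data.Bool.≟ true) (combinations k (edges H)))
  where import Data.Bool

-- binom([n], r) − binom([s,n], r): r-subsets of [n] meeting [s-1] = {1,…,s-1}
-- (vertex i : Fin n stands for toℕ i + 1, so it lies in [s-1] iff toℕ i + 1 < s)
Extremal : ∀ n → ℕ → ℕ → Hypergraph n
Extremal n s r e = (∣ e ∣ ≡ᵇ r) ∧ any (λ i → lookup e i ∧ (suc (toℕ i) <ᵇ s)) (Data.List.allFin n)
  where import Data.List

-- A copy of S^r_{r-1,k} (k ≥ 2) is determined by its kernel, the common intersection of any two of its edges,
-- so N(S^r_{r-1,k}, H) = Σ_T C(deg_H T, k) over the (r − 1)-sets T. Let E = binom([n], r) − binom([s, n], r).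
-- If H ⊆ E, degrees can only drop, and they drop strictly at a kernel inside an edge of E ∖ H.
-- Otherwise H has an edge missing [s − 1]. Split [n] into a core [c] of bounded size and m further vertices.
-- Since H is shifted, moving edges down into the core would give s pairwise disjoint edges if some edge met the
-- core only in the vertex s − 1, or met it in at most one vertex and missed [s − 1]. Hence the C(m, r − 2) kernels
-- {s − 1} ∪ Q with Q outside the core have H-degree at most c instead of n − r + 1, while every other kernel has
-- at most C(c, k) more H-stars than E-stars, or C(n, k) more for the O(m^{r−3}) kernels with two or more core vertices.
-- For m large the loss, of order m^{r−2+k}, exceeds the gain, of order m^{r−1} + m^{r−3+k}.

module Submission where

open import Data.Bool using (Bool; true; false; _∧_; _∨_; not; if_then_else_)
import Data.Bool as Bool
open import Data.Bool.ListAction using (all; any)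
open import Data.Bool.Properties
  using (∧-assoc; ∧-conicalˡ; ∧-conicalʳ; ∧-identityʳ; ∧-zeroʳ; ∨-zeroʳ; ∨-conicalʳ; ⇔→≡; ¬-not; T-≡)
open import Data.Empty using (⊥; ⊥-elim)
open import Data.Fin using (Fin; toℕ; fromℕ<) renaming (zero to fzero; suc to fsuc)
import Data.Fin as Fin using (_≟_)
open import Data.Fin.Properties using (toℕ-fromℕ<; toℕ-injective; toℕ<n; any?)
open import Data.Fin.Subset using (Subset; ∣_∣; _∩_; _─_; inside; outside)
import Data.Fin.Subset as Subset using (⊥)
open import Data.Fin.Subset.Properties using (∣p∣≤n; ∩-comm; anySubset?)
open import Data.List as List using (List; []; _∷_; map; _++_; filter; length)
open import Data.List.Membership.Propositional using (_∈_)
open import Data.List.Membership.Propositional.Properties using (∈-map⁻; ∈-map⁺; ∈-++⁺ˡ; ∈-++⁺ʳ)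
open import Data.List.Properties using (filter-≐)
open import Data.List.Relation.Unary.All as All using (All; []; _∷_)
import Data.List.Relation.Unary.All.Properties as All
open import Data.List.Relation.Unary.AllPairs as AllPairs using (AllPairs; []; _∷_)
open import Data.List.Relation.Unary.Any using (here; there)
open import Data.List.Relation.Unary.Unique.Propositional using (Unique)
import Data.List.Relation.Unary.Unique.Propositional.Properties as Unique
open import Data.Nat
open import Data.Nat.Combinatorics using (_C_; nCk≡nC[n∸k]; nCn≡1; nC1≡n; nCk+nC[k+1]≡[n+1]C[k+1]; k>n⇒nCk≡0)
open import Data.Nat.DivMod using (_/_; _%_; m≡m%n+[m/n]*n; m%n<n)
open import Data.Nat.Properties
open import Data.Nat.Tactic.RingSolver using (solve-∀)
open import Data.Product using (_×_; _,_; proj₁; proj₂; ∃; ∃-syntax)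
open import Data.Sum using (_⊎_; inj₁; inj₂)
open import Data.Vec using ([]; _∷_; lookup; tabulate; _[_]≔_) renaming (_++_ to _++ᵛ_)
open import Data.Vec.Properties using (∷-injectiveʳ; lookup∘tabulate; lookup∘update; lookup∘update′; lookup-++-<)
open import Defs
open import Function using (_∘_)
open import Function.Bundles using (Equivalence; _⇔_; mk⇔)
open import Relation.Binary.Definitions using (tri<; tri≈; tri>)
open import Relation.Binary.PropositionalEquality
open import Relation.Nullary using (¬_; Dec; yes; no; _×-dec_; contradiction)

private variable
  A B : Set

-- Sums and counting over lists

𝟙 : Bool → ℕ
𝟙 true = 1
𝟙 false = 0

∑ : (A → ℕ) → List A → ℕ
∑ f [] = 0
∑ f (x ∷ xs) = f x + ∑ f xs

count : (A → Bool) → List A → ℕ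
count p = ∑ (𝟙 ∘ p)

∑-zero : ∀ {f : A → ℕ} xs → (∀ x → f x ≡ 0) → ∑ f xs ≡ 0
∑-zero [] _ = refl
∑-zero (x ∷ xs) f≡0 rewrite f≡0 x = ∑-zero xs f≡0

∑-++ : ∀ (f : A → ℕ) xs ys → ∑ f (xs ++ ys) ≡ ∑ f xs + ∑ f ys
∑-++ f [] ys = refl
∑-++ f (x ∷ xs) ys = trans (cong (f x +_) (∑-++ f xs ys)) (sym (+-assoc (f x) _ _))

∑-map : ∀ (f : B → ℕ) (g : A → B) xs → ∑ f (map g xs) ≡ ∑ (f ∘ g) xs
∑-map f g [] = refl
∑-map f g (x ∷ xs) = cong (f (g x) +_) (∑-map f g xs)

∑-cong : ∀ {f g : A → ℕ} xs → (∀ x → f x ≡ g x) → ∑ f xs ≡ ∑ g xs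
∑-cong [] _ = refl
∑-cong (x ∷ xs) f≗g = cong₂ _+_ (f≗g x) (∑-cong xs f≗g)

∑-congᴬ : ∀ {f g : A → ℕ} {xs} → All (λ x → f x ≡ g x) xs → ∑ f xs ≡ ∑ g xs
∑-congᴬ [] = refl
∑-congᴬ (fx≡gx ∷ rest) = cong₂ _+_ fx≡gx (∑-congᴬ rest)

∑-mono-≤ : ∀ {f g : A → ℕ} xs → (∀ x → f x ≤ g x) → ∑ f xs ≤ ∑ g xs
∑-mono-≤ [] _ = z≤n
∑-mono-≤ (x ∷ xs) f≤g = +-mono-≤ (f≤g x) (∑-mono-≤ xs f≤g)

∑-mono-< : ∀ {f g : A → ℕ} xs → (∀ x → f x ≤ g x) →
           ∀ {z} → z ∈ xs → f z < g z → ∑ f xs < ∑ g xs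
∑-mono-< (x ∷ xs) f≤g (here refl) fz<gz = +-mono-<-≤ fz<gz (∑-mono-≤ xs f≤g)
∑-mono-< (x ∷ xs) f≤g (there z∈xs) fz<gz = +-mono-≤-< (f≤g x) (∑-mono-< xs f≤g z∈xs fz<gz)

∑-distrib-+ : ∀ (f g : A → ℕ) xs → ∑ (λ x → f x + g x) xs ≡ ∑ f xs + ∑ g xs
∑-distrib-+ f g [] = refl
∑-distrib-+ f g (x ∷ xs) rewrite ∑-distrib-+ f g xs = interchange (f x) (g x) (∑ f xs) (∑ g xs)
  where
  interchange : ∀ a b c d → a + b + (c + d) ≡ a + c + (b + d)
  interchange = solve-∀

∑-distribʳ-* : ∀ (f : A → ℕ) c xs → ∑ (λ x → f x * c) xs ≡ ∑ f xs * c
∑-distribʳ-* f c [] = refl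
∑-distribʳ-* f c (x ∷ xs) rewrite ∑-distribʳ-* f c xs = sym (*-distribʳ-+ c (f x) (∑ f xs))

∑-comm : ∀ (f : A → B → ℕ) xs ys →
         ∑ (λ x → ∑ (f x) ys) xs ≡ ∑ (λ y → ∑ (λ x → f x y) xs) ys
∑-comm f [] ys = sym (∑-zero ys (λ _ → refl))
∑-comm f (x ∷ xs) ys rewrite ∑-comm f xs ys = sym (∑-distrib-+ (f x) (λ y → ∑ (λ x′ → f x′ y) xs) ys)

count-mono : ∀ {p q : A → Bool} xs → (∀ x → p x ≡ true → q x ≡ true) → count p xs ≤ count q xs
count-mono {p = p} {q = q} xs p⇒q = ∑-mono-≤ xs 𝟙p≤𝟙q
  where
  𝟙p≤𝟙q : ∀ x → 𝟙 (p x) ≤ 𝟙 (q x)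
  𝟙p≤𝟙q x with p x in px
  ... | false = z≤n
  ... | true rewrite p⇒q x px = ≤-refl

count-none : ∀ {p : A → Bool} xs → All (λ x → p x ≡ false) xs → count p xs ≡ 0
count-none [] [] = refl
count-none (x ∷ xs) (px≡false ∷ rest) rewrite px≡false = count-none xs rest

count≡𝟙-any : ∀ (p : A → Bool) {xs} → AllPairs (λ x y → p x ≡ true → p y ≡ false) xs →
              count p xs ≡ 𝟙 (any p xs)
count≡𝟙-any p [] = refl
count≡𝟙-any p {x ∷ xs} (px⇒rest ∷ pairs) with p x
... | true = cong suc (count-none xs (All.map (λ px⇒py → px⇒py refl) px⇒rest))
... | false = count≡𝟙-any p pairs

length-filter≡count : ∀ (p : A → Bool) xs → length (filter (λ x → p x Bool.≟ true) xs) ≡ count p xs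
length-filter≡count p [] = refl
length-filter≡count p (x ∷ xs) with p x
... | true = cong suc (length-filter≡count p xs)
... | false = length-filter≡count p xs

count-filter : ∀ (p q : A → Bool) xs → count p (filter (λ x → q x Bool.≟ true) xs) ≡ count (λ x → q x ∧ p x) xs
count-filter p q [] = refl
count-filter p q (x ∷ xs) with q x
... | true = cong (𝟙 (p x) +_) (count-filter p q xs)
... | false = count-filter p q xs

false≢true : false ≢ true
false≢true ()

≡ᵇ-sound : ∀ {m n} → (m ≡ᵇ n) ≡ true → m ≡ n
≡ᵇ-sound {m} {n} eq = ≡ᵇ⇒≡ m n (Equivalence.from T-≡ eq)

≡ᵇ-refl : ∀ m → (m ≡ᵇ m) ≡ true
≡ᵇ-refl m = Equivalence.to T-≡ (≡⇒≡ᵇ m m refl)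

≡ᵇ-false : ∀ {m n} → m ≢ n → (m ≡ᵇ n) ≡ false
≡ᵇ-false {m} {n} m≢n with m ≡ᵇ n in eq
... | true = ⊥-elim (m≢n (≡ᵇ-sound eq))
... | false = refl

<ᵇ-sound : ∀ {m n} → (m <ᵇ n) ≡ true → m < n
<ᵇ-sound {m} {n} lt = <ᵇ⇒< m n (Equivalence.from T-≡ lt)

<ᵇ-complete : ∀ {m n} → m < n → (m <ᵇ n) ≡ true
<ᵇ-complete m<n = Equivalence.to T-≡ (<⇒<ᵇ m<n)

<ᵇ-false : ∀ {m n} → m ≮ n → (m <ᵇ n) ≡ false
<ᵇ-false {m} {n} m≮n with m <ᵇ n in lt
... | true = ⊥-elim (m≮n (<ᵇ-sound lt))
... | false = refl

≤ᵇ-sound : ∀ {m n} → (m ≤ᵇ n) ≡ true → m ≤ n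
≤ᵇ-sound {m} {n} le = ≤ᵇ⇒≤ m n (Equivalence.from T-≡ le)

≤ᵇ-complete : ∀ {m n} → m ≤ n → (m ≤ᵇ n) ≡ true
≤ᵇ-complete m≤n = Equivalence.to T-≡ (≤⇒≤ᵇ m≤n)

≤ᵇ-false : ∀ {m n} → m ≰ n → (m ≤ᵇ n) ≡ false
≤ᵇ-false {m} {n} m≰n with m ≤ᵇ n in le
... | true = ⊥-elim (m≰n (≤ᵇ-sound le))
... | false = refl

∧-intro : ∀ {a b} → a ≡ true → b ≡ true → a ∧ b ≡ true
∧-intro refl refl = refl

-- Binomial coefficients

nC0≡1 : ∀ n → n C 0 ≡ 1
nC0≡1 n = trans (nCk≡nC[n∸k] (z≤n {n})) (nCn≡1 n)

C-suc-≤ : ∀ a j → a C j ≤ suc a C j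
C-suc-≤ a zero = ≤-reflexive (trans (nC0≡1 a) (sym (nC0≡1 (suc a))))
C-suc-≤ a (suc j) = ≤-trans (m≤n+m (a C suc j) (a C j)) (≤-reflexive (nCk+nC[k+1]≡[n+1]C[k+1] a j))

C-monoˡ-≤ : ∀ j {a b} → a ≤ b → a C j ≤ b C j
C-monoˡ-≤ j {a} {b} a≤b = subst (λ z → a C j ≤ z C j) (m+[n∸m]≡n a≤b) (go (b ∸ a))
  where
  go : ∀ d → a C j ≤ (a + d) C j
  go zero = ≤-reflexive (cong (_C j) (sym (+-identityʳ a)))
  go (suc d) = ≤-trans (go d) (≤-trans (C-suc-≤ (a + d) j) (≤-reflexive (cong (_C j) (sym (+-suc a d)))))

C≤^ : ∀ a j → a C j ≤ a ^ j
C≤^ a zero = ≤-reflexive (nC0≡1 a)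
C≤^ zero (suc j) = z≤n
C≤^ (suc a) (suc j) = begin
  suc a C suc j          ≡⟨ nCk+nC[k+1]≡[n+1]C[k+1] a j ⟨
  a C j + a C suc j      ≤⟨ +-mono-≤ (C≤^ a j) (C≤^ a (suc j)) ⟩
  a ^ j + a * a ^ j      ≡⟨⟩
  suc a * a ^ j          ≤⟨ *-monoʳ-≤ (suc a) (^-monoˡ-≤ j (n≤1+n a)) ⟩
  suc a * suc a ^ j      ∎
  where open ≤-Reasoning

*C≤C-suc : ∀ t a j → t * (a C j) ≤ (a + t) C suc j
*C≤C-suc zero a j = z≤n
*C≤C-suc (suc t) a j = begin
  a C j + t * (a C j)                  ≤⟨ +-mono-≤ (C-monoˡ-≤ j (m≤m+n a t)) (*C≤C-suc t a j) ⟩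
  (a + t) C j + (a + t) C suc j        ≡⟨ nCk+nC[k+1]≡[n+1]C[k+1] (a + t) j ⟩
  suc (a + t) C suc j                  ≡⟨ cong (_C suc j) (+-suc a t) ⟨
  (a + suc t) C suc j                  ∎
  where open ≤-Reasoning

^≤C : ∀ t j {a} → j * t ≤ a → t ^ j ≤ a C j
^≤C t j {a} jt≤a = ≤-trans (go j) (C-monoˡ-≤ j jt≤a)
  where
  go : ∀ j → t ^ j ≤ (j * t) C j
  go zero = ≤-reflexive (sym (nC0≡1 0))
  go (suc j) = begin
    t * t ^ j            ≤⟨ *-monoʳ-≤ t (go j) ⟩
    t * ((j * t) C j)    ≤⟨ *C≤C-suc t (j * t) j ⟩
    (j * t + t) C suc j  ≡⟨ cong (_C suc j) (+-comm (j * t) t) ⟩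
    (suc j * t) C suc j  ∎
    where open ≤-Reasoning

C-pos : ∀ {a j} → j ≤ a → 1 ≤ a C j
C-pos {a} {zero} _ = ≤-reflexive (sym (nC0≡1 a))
C-pos {suc a} {suc j} (s≤s j≤a) = ≤-trans (C-pos j≤a) (≤-trans (m≤m+n (a C j) (a C suc j)) (≤-reflexive (nCk+nC[k+1]≡[n+1]C[k+1] a j)))

C-monoˡ-< : ∀ {a b k} → 1 ≤ k → a < b → k ≤ b → a C k < b C k
C-monoˡ-< {a} {b} {suc k} _ a<b k<b with k ≤? a
... | yes k≤a = begin-strict
  a C suc k                    <⟨ m<n+m (a C suc k) (C-pos k≤a) ⟩
  a C k + a C suc k            ≡⟨ nCk+nC[k+1]≡[n+1]C[k+1] a k ⟩
  suc a C suc k                ≤⟨ C-monoˡ-≤ (suc k) a<b ⟩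
  b C suc k                    ∎
  where open ≤-Reasoning
... | no k≰a = begin-strict
  a C suc k                    ≡⟨ k>n⇒nCk≡0 (m<n⇒m<1+n (≰⇒> k≰a)) ⟩
  0                            <⟨ C-pos k<b ⟩
  b C suc k                    ∎
  where open ≤-Reasoning

-- Subsets of [n]

_⊆ᵇ_ : ∀ {n} → Subset n → Subset n → Bool
[] ⊆ᵇ [] = true
(a ∷ p) ⊆ᵇ (b ∷ q) = (not a ∨ b) ∧ (p ⊆ᵇ q)

⊆ᵇ-refl : ∀ {n} (p : Subset n) → (p ⊆ᵇ p) ≡ true
⊆ᵇ-refl [] = refl
⊆ᵇ-refl (true ∷ p) = ⊆ᵇ-refl p
⊆ᵇ-refl (false ∷ p) = ⊆ᵇ-refl p

⊆ᵇ⇒∣≤∣ : ∀ {n} (p q : Subset n) → (p ⊆ᵇ q) ≡ true → ∣ p ∣ ≤ ∣ q ∣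
⊆ᵇ⇒∣≤∣ [] [] _ = z≤n
⊆ᵇ⇒∣≤∣ (true ∷ p) (true ∷ q) p⊆q = s≤s (⊆ᵇ⇒∣≤∣ p q p⊆q)
⊆ᵇ⇒∣≤∣ (false ∷ p) (true ∷ q) p⊆q = m≤n⇒m≤1+n (⊆ᵇ⇒∣≤∣ p q p⊆q)
⊆ᵇ⇒∣≤∣ (false ∷ p) (false ∷ q) p⊆q = ⊆ᵇ⇒∣≤∣ p q p⊆q

⊆ᵇ∧∣≥∣⇒≡ : ∀ {n} (p q : Subset n) → (p ⊆ᵇ q) ≡ true → ∣ q ∣ ≤ ∣ p ∣ → p ≡ q
⊆ᵇ∧∣≥∣⇒≡ [] [] _ _ = refl
⊆ᵇ∧∣≥∣⇒≡ (true ∷ p) (true ∷ q) p⊆q (s≤s q≤p) = cong (true ∷_) (⊆ᵇ∧∣≥∣⇒≡ p q p⊆q q≤p)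
⊆ᵇ∧∣≥∣⇒≡ (false ∷ p) (true ∷ q) p⊆q q≤p = contradiction q≤p (<⇒≱ (s≤s (⊆ᵇ⇒∣≤∣ p q p⊆q)))
⊆ᵇ∧∣≥∣⇒≡ (false ∷ p) (false ∷ q) p⊆q q≤p = cong (false ∷_) (⊆ᵇ∧∣≥∣⇒≡ p q p⊆q q≤p)

⊆ᵇ-∩ : ∀ {n} (t p q : Subset n) → (t ⊆ᵇ p) ≡ true → (t ⊆ᵇ q) ≡ true → (t ⊆ᵇ (p ∩ q)) ≡ true
⊆ᵇ-∩ [] [] [] _ _ = refl
⊆ᵇ-∩ (true ∷ t) (true ∷ p) (true ∷ q) t⊆p t⊆q = ⊆ᵇ-∩ t p q t⊆p t⊆q
⊆ᵇ-∩ (false ∷ t) (a ∷ p) (b ∷ q) t⊆p t⊆q =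
  ⊆ᵇ-∩ t p q (∧-conicalʳ (not false ∨ a) _ t⊆p) (∧-conicalʳ (not false ∨ b) _ t⊆q)

∩-⊆ᵇˡ : ∀ {n} (p q : Subset n) → ((p ∩ q) ⊆ᵇ p) ≡ true
∩-⊆ᵇˡ [] [] = refl
∩-⊆ᵇˡ (true ∷ p) (true ∷ q) = ∩-⊆ᵇˡ p q
∩-⊆ᵇˡ (true ∷ p) (false ∷ q) = ∩-⊆ᵇˡ p q
∩-⊆ᵇˡ (false ∷ p) (b ∷ q) = ∩-⊆ᵇˡ p q

∩-⊆ᵇʳ : ∀ {n} (p q : Subset n) → ((p ∩ q) ⊆ᵇ q) ≡ true
∩-⊆ᵇʳ [] [] = refl
∩-⊆ᵇʳ (true ∷ p) (true ∷ q) = ∩-⊆ᵇʳ p q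
∩-⊆ᵇʳ (false ∷ p) (true ∷ q) = ∩-⊆ᵇʳ p q
∩-⊆ᵇʳ (true ∷ p) (false ∷ q) = ∩-⊆ᵇʳ p q
∩-⊆ᵇʳ (false ∷ p) (false ∷ q) = ∩-⊆ᵇʳ p q

==ˢ-refl : ∀ {n} (p : Subset n) → (p ==ˢ p) ≡ true
==ˢ-refl [] = refl
==ˢ-refl (true ∷ p) = ==ˢ-refl p
==ˢ-refl (false ∷ p) = ==ˢ-refl p

==ˢ⇒≡ : ∀ {n} (p q : Subset n) → (p ==ˢ q) ≡ true → p ≡ q
==ˢ⇒≡ [] [] _ = refl
==ˢ⇒≡ (true ∷ p) (true ∷ q) p==q = cong (true ∷_) (==ˢ⇒≡ p q p==q)
==ˢ⇒≡ (false ∷ p) (false ∷ q) p==q = cong (false ∷_) (==ˢ⇒≡ p q p==q)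

∣++ᵛ∣ : ∀ {c m} (p : Subset c) (q : Subset m) → ∣ p ++ᵛ q ∣ ≡ ∣ p ∣ + ∣ q ∣
∣++ᵛ∣ [] q = refl
∣++ᵛ∣ (true ∷ p) q = cong suc (∣++ᵛ∣ p q)
∣++ᵛ∣ (false ∷ p) q = ∣++ᵛ∣ p q

⊆ᵇ-++ᵛ : ∀ {c m} (p p′ : Subset c) (q q′ : Subset m) →
         ((p ++ᵛ q) ⊆ᵇ (p′ ++ᵛ q′)) ≡ (p ⊆ᵇ p′) ∧ (q ⊆ᵇ q′)
⊆ᵇ-++ᵛ [] [] q q′ = refl
⊆ᵇ-++ᵛ (a ∷ p) (b ∷ p′) q q′ rewrite ⊆ᵇ-++ᵛ p p′ q q′ = sym (∧-assoc (not a ∨ b) (p ⊆ᵇ p′) (q ⊆ᵇ q′))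

allSubsets-unique : ∀ n → Unique (allSubsets n)
allSubsets-unique zero = [] ∷ []
allSubsets-unique (suc n) =
  Unique.++⁺ (Unique.map⁺ ∷-injectiveʳ (allSubsets-unique n)) (Unique.map⁺ ∷-injectiveʳ (allSubsets-unique n))
    different-heads
  where
  different-heads : ∀ {p} → ¬ (p ∈ map (true ∷_) (allSubsets n) × p ∈ map (false ∷_) (allSubsets n))
  different-heads (p∈t , p∈f) with ∈-map⁻ (true ∷_) p∈t | ∈-map⁻ (false ∷_) p∈f
  ... | _ , _ , refl | _ , _ , ()

∈-allSubsets : ∀ {n} (p : Subset n) → p ∈ allSubsets n
∈-allSubsets [] = here refl
∈-allSubsets {suc n} (true ∷ p) = ∈-++⁺ˡ (∈-map⁺ (true ∷_) (∈-allSubsets p))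
∈-allSubsets {suc n} (false ∷ p) = ∈-++⁺ʳ (map (true ∷_) (allSubsets n)) (∈-map⁺ (false ∷_) (∈-allSubsets p))

∑-allSubsets-suc : ∀ n (f : Subset (suc n) → ℕ) →
  ∑ f (allSubsets (suc n)) ≡ ∑ (λ p → f (true ∷ p)) (allSubsets n) + ∑ (λ p → f (false ∷ p)) (allSubsets n)
∑-allSubsets-suc n f = trans (∑-++ f (map (true ∷_) (allSubsets n)) (map (false ∷_) (allSubsets n)))
  (cong₂ _+_ (∑-map f (true ∷_) (allSubsets n)) (∑-map f (false ∷_) (allSubsets n)))

∑-allSubsets-++ᵛ : ∀ c m (f : Subset (c + m) → ℕ) →
  ∑ f (allSubsets (c + m)) ≡ ∑ (λ p → ∑ (λ q → f (p ++ᵛ q)) (allSubsets m)) (allSubsets c)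
∑-allSubsets-++ᵛ zero m f = sym (+-identityʳ _)
∑-allSubsets-++ᵛ (suc c) m f
  rewrite ∑-allSubsets-suc (c + m) f
        | ∑-allSubsets-suc c (λ p → ∑ (λ q → f (p ++ᵛ q)) (allSubsets m))
        | ∑-allSubsets-++ᵛ c m (λ v → f (true ∷ v))
        | ∑-allSubsets-++ᵛ c m (λ v → f (false ∷ v)) = refl

∑-allSubsets-const : ∀ n x → ∑ (λ _ → x) (allSubsets n) ≡ 2 ^ n * x
∑-allSubsets-const zero x = refl
∑-allSubsets-const (suc n) x rewrite ∑-allSubsets-suc n (λ _ → x) | ∑-allSubsets-const n x =
  sym (trans (*-distribʳ-+ x (2 ^ n) (2 ^ n + 0)) (cong (λ z → 2 ^ n * x + z * x) (+-identityʳ (2 ^ n))))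

∑-allSubsets-δ : ∀ n (w : Subset n) (g : Subset n → ℕ) →
  ∑ (λ p → if p ==ˢ w then g p else 0) (allSubsets n) ≡ g w
∑-allSubsets-δ zero [] g = +-identityʳ (g [])
∑-allSubsets-δ (suc n) (true ∷ w) g
  rewrite ∑-allSubsets-suc n (λ p → if p ==ˢ (true ∷ w) then g p else 0)
        | ∑-allSubsets-δ n w (λ p → g (true ∷ p))
        | ∑-zero {f = λ (p : Subset n) → 0} (allSubsets n) (λ _ → refl) = +-identityʳ _
∑-allSubsets-δ (suc n) (false ∷ w) g
  rewrite ∑-allSubsets-suc n (λ p → if p ==ˢ (false ∷ w) then g p else 0)
        | ∑-allSubsets-δ n w (λ p → g (false ∷ p))
        | ∑-zero {f = λ (p : Subset n) → 0} (allSubsets n) (λ _ → refl) = refl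

lookup≡true⇒0<∣p∣ : ∀ {n} (p : Subset n) v → lookup p v ≡ true → 0 < ∣ p ∣
lookup≡true⇒0<∣p∣ (true ∷ p) v _ = z<s
lookup≡true⇒0<∣p∣ (false ∷ p) (fsuc v) pv = lookup≡true⇒0<∣p∣ p v pv

∣p∣≤1⇒unique : ∀ {n} (p : Subset n) → ∣ p ∣ ≤ 1 → ∀ v w → lookup p v ≡ true → lookup p w ≡ true → v ≡ w
∣p∣≤1⇒unique (true ∷ p) _ fzero fzero _ _ = refl
∣p∣≤1⇒unique (true ∷ p) (s≤s ∣p∣≤0) fzero (fsuc w) _ pw = ⊥-elim (<⇒≱ (lookup≡true⇒0<∣p∣ p w pw) ∣p∣≤0)
∣p∣≤1⇒unique (true ∷ p) (s≤s ∣p∣≤0) (fsuc v) _ pv _ = ⊥-elim (<⇒≱ (lookup≡true⇒0<∣p∣ p v pv) ∣p∣≤0)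
∣p∣≤1⇒unique (false ∷ p) ∣p∣≤1 (fsuc v) (fsuc w) pv pw = cong fsuc (∣p∣≤1⇒unique p ∣p∣≤1 v w pv pw)

count-allSubsets-∣∣≡ : ∀ n j → count (λ p → ∣ p ∣ ≡ᵇ j) (allSubsets n) ≡ n C j
count-allSubsets-∣∣≡ zero zero = refl
count-allSubsets-∣∣≡ zero (suc j) = refl
count-allSubsets-∣∣≡ (suc n) zero
  rewrite ∑-allSubsets-suc n (λ p → 𝟙 (∣ p ∣ ≡ᵇ zero)) | count-allSubsets-∣∣≡ n zero
        | ∑-zero {f = λ (p : Subset n) → 0} (allSubsets n) (λ _ → refl) = sym (nC0≡1 (suc n))
count-allSubsets-∣∣≡ (suc n) (suc j)
  rewrite ∑-allSubsets-suc n (λ p → 𝟙 (∣ p ∣ ≡ᵇ suc j)) | count-allSubsets-∣∣≡ n j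
        | count-allSubsets-∣∣≡ n (suc j) = nCk+nC[k+1]≡[n+1]C[k+1] n j

count-supersets : ∀ n (t : Subset n) j →
  count (λ p → (t ⊆ᵇ p) ∧ (∣ p ∣ ≡ᵇ ∣ t ∣ + j)) (allSubsets n) ≡ (n ∸ ∣ t ∣) C j
count-supersets zero [] zero = refl
count-supersets zero [] (suc j) = refl
count-supersets (suc n) (true ∷ t) j
  rewrite ∑-allSubsets-suc n (λ p → 𝟙 (((true ∷ t) ⊆ᵇ p) ∧ (∣ p ∣ ≡ᵇ ∣ true ∷ t ∣ + j)))
        | count-supersets n t j
        | ∑-zero {f = λ (p : Subset n) → 0} (allSubsets n) (λ _ → refl) = +-identityʳ _
count-supersets (suc n) (false ∷ t) zero = begin
  count (λ p → ((false ∷ t) ⊆ᵇ p) ∧ (∣ p ∣ ≡ᵇ ∣ t ∣ + 0)) (allSubsets (suc n))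
    ≡⟨ ∑-allSubsets-suc n _ ⟩
  count (λ p → (t ⊆ᵇ p) ∧ (suc ∣ p ∣ ≡ᵇ ∣ t ∣ + 0)) (allSubsets n) + count (λ p → (t ⊆ᵇ p) ∧ (∣ p ∣ ≡ᵇ ∣ t ∣ + 0)) (allSubsets n)
    ≡⟨ cong₂ _+_ (∑-zero (allSubsets n) too-large) (count-supersets n t zero) ⟩
  (n ∸ ∣ t ∣) C 0        ≡⟨ nC0≡1 (n ∸ ∣ t ∣) ⟩
  1                      ≡⟨ nC0≡1 (suc n ∸ ∣ t ∣) ⟨
  (suc n ∸ ∣ t ∣) C 0    ∎
  where
  open ≡-Reasoning
  too-large : ∀ p → 𝟙 ((t ⊆ᵇ p) ∧ (suc ∣ p ∣ ≡ᵇ ∣ t ∣ + 0)) ≡ 0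
  too-large p with t ⊆ᵇ p in t⊆p
  ... | false = refl
  ... | true rewrite +-identityʳ ∣ t ∣ =
    cong 𝟙 (≡ᵇ-false (λ eq → <-irrefl (sym eq) (s≤s (⊆ᵇ⇒∣≤∣ t p t⊆p))))
count-supersets (suc n) (false ∷ t) (suc j) = begin
  count (λ p → ((false ∷ t) ⊆ᵇ p) ∧ (∣ p ∣ ≡ᵇ ∣ t ∣ + suc j)) (allSubsets (suc n))
    ≡⟨ ∑-allSubsets-suc n _ ⟩
  count (λ p → (t ⊆ᵇ p) ∧ (suc ∣ p ∣ ≡ᵇ ∣ t ∣ + suc j)) (allSubsets n) + count (λ p → (t ⊆ᵇ p) ∧ (∣ p ∣ ≡ᵇ ∣ t ∣ + suc j)) (allSubsets n)
    ≡⟨ cong (λ z → count (λ p → (t ⊆ᵇ p) ∧ (suc ∣ p ∣ ≡ᵇ z)) (allSubsets n) + count (λ p → (t ⊆ᵇ p) ∧ (∣ p ∣ ≡ᵇ ∣ t ∣ + suc j)) (allSubsets n))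
         (+-suc ∣ t ∣ j) ⟩
  count (λ p → (t ⊆ᵇ p) ∧ (∣ p ∣ ≡ᵇ ∣ t ∣ + j)) (allSubsets n) + count (λ p → (t ⊆ᵇ p) ∧ (∣ p ∣ ≡ᵇ ∣ t ∣ + suc j)) (allSubsets n)
    ≡⟨ cong₂ _+_ (count-supersets n t j) (count-supersets n t (suc j)) ⟩
  (n ∸ ∣ t ∣) C j + (n ∸ ∣ t ∣) C suc j ≡⟨ nCk+nC[k+1]≡[n+1]C[k+1] (n ∸ ∣ t ∣) j ⟩
  suc (n ∸ ∣ t ∣) C suc j               ≡⟨ cong (_C suc j) (+-∸-assoc 1 (∣p∣≤n t)) ⟨
  (suc n ∸ ∣ t ∣) C suc j               ∎
  where open ≡-Reasoning

∣∷∣ : ∀ {n} x (p : Subset n) → ∣ x ∷ p ∣ ≡ 𝟙 x + ∣ p ∣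
∣∷∣ true p = refl
∣∷∣ false p = refl

∣∷─∷∣ : ∀ {n} x y (p q : Subset n) → ∣ (x ∷ p) ─ (y ∷ q) ∣ ≡ 𝟙 (x ∧ not y) + ∣ p ─ q ∣
∣∷─∷∣ true false p q = refl
∣∷─∷∣ false false p q = refl
∣∷─∷∣ true true p q = refl
∣∷─∷∣ false true p q = refl

private
  +-rotate : ∀ a b c → a + b + c ≡ c + b + a
  +-rotate a b c = trans (+-comm (a + b) c) (trans (cong (c +_) (+-comm a b)) (sym (+-assoc c b a)))

  +-cong-tail : ∀ a {b c d e} → b + c ≡ d + e → a + b + c ≡ a + d + e
  +-cong-tail a {b} {c} {d} {e} eq = trans (+-assoc a b c) (trans (cong (a +_) eq) (sym (+-assoc a d e)))

∣∣-update : ∀ {n} (p : Subset n) x b → ∣ p [ x ]≔ b ∣ + 𝟙 (lookup p x) ≡ ∣ p ∣ + 𝟙 b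
∣∣-update (a ∷ p) fzero b rewrite ∣∷∣ a p | ∣∷∣ b p = +-rotate (𝟙 b) ∣ p ∣ (𝟙 a)
∣∣-update (a ∷ p) (fsuc x) b rewrite ∣∷∣ a p | ∣∷∣ a (p [ x ]≔ b) = +-cong-tail (𝟙 a) (∣∣-update p x b)

∣─∣-update : ∀ {n} (p q : Subset n) x b →
             ∣ (p [ x ]≔ b) ─ q ∣ + 𝟙 (lookup p x ∧ not (lookup q x)) ≡ ∣ p ─ q ∣ + 𝟙 (b ∧ not (lookup q x))
∣─∣-update (a ∷ p) (c ∷ q) fzero b rewrite ∣∷─∷∣ a c p q | ∣∷─∷∣ b c p q =
  +-rotate (𝟙 (b ∧ not c)) ∣ p ─ q ∣ (𝟙 (a ∧ not c))
∣─∣-update (a ∷ p) (c ∷ q) (fsuc x) b rewrite ∣∷─∷∣ a c p q | ∣∷─∷∣ a c (p [ x ]≔ b) q =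
  +-cong-tail (𝟙 (a ∧ not c)) (∣─∣-update p q x b)

∣p∣≡∣p∩q∣+∣p─q∣ : ∀ {n} (p q : Subset n) → ∣ p ∣ ≡ ∣ p ∩ q ∣ + ∣ p ─ q ∣
∣p∣≡∣p∩q∣+∣p─q∣ [] [] = refl
∣p∣≡∣p∩q∣+∣p─q∣ (true ∷ p) (true ∷ q) = cong suc (∣p∣≡∣p∩q∣+∣p─q∣ p q)
∣p∣≡∣p∩q∣+∣p─q∣ (true ∷ p) (false ∷ q) = trans (cong suc (∣p∣≡∣p∩q∣+∣p─q∣ p q)) (sym (+-suc _ _))
∣p∣≡∣p∩q∣+∣p─q∣ (false ∷ p) (true ∷ q) = ∣p∣≡∣p∩q∣+∣p─q∣ p q
∣p∣≡∣p∩q∣+∣p─q∣ (false ∷ p) (false ∷ q) = ∣p∣≡∣p∩q∣+∣p─q∣ p q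

∣p─q∣≡∣q─p∣ : ∀ {n} (p q : Subset n) → ∣ p ∣ ≡ ∣ q ∣ → ∣ p ─ q ∣ ≡ ∣ q ─ p ∣
∣p─q∣≡∣q─p∣ p q ∣p∣≡∣q∣ = +-cancelˡ-≡ ∣ p ∩ q ∣ _ _ (begin
  ∣ p ∩ q ∣ + ∣ p ─ q ∣ ≡⟨ ∣p∣≡∣p∩q∣+∣p─q∣ p q ⟨
  ∣ p ∣                 ≡⟨ ∣p∣≡∣q∣ ⟩
  ∣ q ∣                 ≡⟨ ∣p∣≡∣p∩q∣+∣p─q∣ q p ⟩
  ∣ q ∩ p ∣ + ∣ q ─ p ∣ ≡⟨ cong (λ s → ∣ s ∣ + ∣ q ─ p ∣) (∩-comm q p) ⟩
  ∣ p ∩ q ∣ + ∣ q ─ p ∣ ∎)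
  where open ≡-Reasoning

∣─∣≡0⇒≡ : ∀ {n} (p q : Subset n) → ∣ p ─ q ∣ ≡ 0 → ∣ q ─ p ∣ ≡ 0 → p ≡ q
∣─∣≡0⇒≡ [] [] _ _ = refl
∣─∣≡0⇒≡ (true ∷ p) (true ∷ q) p─q q─p = cong (true ∷_) (∣─∣≡0⇒≡ p q p─q q─p)
∣─∣≡0⇒≡ (false ∷ p) (false ∷ q) p─q q─p = cong (false ∷_) (∣─∣≡0⇒≡ p q p─q q─p)

∣─∣≢0⇒witness : ∀ {n} (p q : Subset n) {d} → ∣ p ─ q ∣ ≡ suc d → ∃[ x ] (lookup p x ≡ true × lookup q x ≡ false)
∣─∣≢0⇒witness [] [] ()
∣─∣≢0⇒witness (true ∷ p) (false ∷ q) _ = fzero , refl , refl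
∣─∣≢0⇒witness (true ∷ p) (true ∷ q) eq with ∣─∣≢0⇒witness p q eq
... | x , px , qx = fsuc x , px , qx
∣─∣≢0⇒witness (false ∷ p) (b ∷ q) eq with ∣─∣≢0⇒witness p q (trans (sym (∣∷─∷∣ false b p q)) eq)
... | x , px , qx = fsuc x , px , qx

-- Counting stars by their kernels

combinations-length : ∀ k (xs : List A) → All (λ ys → length ys ≡ k) (combinations k xs)
combinations-length zero xs = refl ∷ []
combinations-length (suc k) [] = []
combinations-length (suc k) (x ∷ xs) =
  All.++⁺ (All.map⁺ (All.map (cong suc) (combinations-length k xs))) (combinations-length (suc k) xs)

combinations-All : ∀ {P : A → Set} k {xs} → All P xs → All (All P) (combinations k xs)
combinations-All zero _ = [] ∷ []
combinations-All (suc k) [] = []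
combinations-All (suc k) (px ∷ pxs) =
  All.++⁺ (All.map⁺ (All.map (px ∷_) (combinations-All k pxs))) (combinations-All (suc k) pxs)

combinations-unique : ∀ k {xs : List A} → Unique xs → All Unique (combinations k xs)
combinations-unique zero _ = [] ∷ []
combinations-unique (suc k) [] = []
combinations-unique (suc k) (x∉xs ∷ xs-unique) =
  All.++⁺ (All.map⁺ (All.zipWith (λ (x∉ys , ys-unique) → x∉ys ∷ ys-unique)
                                  (combinations-All k x∉xs , combinations-unique k xs-unique)))
          (combinations-unique (suc k) xs-unique)

count-all-combinations : ∀ (p : A → Bool) k xs → count (all p) (combinations k xs) ≡ count p xs C k
count-all-combinations p zero xs = refl
count-all-combinations p (suc k) [] = refl
count-all-combinations p (suc k) (x ∷ xs)
  rewrite ∑-++ (𝟙 ∘ all p) (map (x ∷_) (combinations k xs)) (combinations (suc k) xs)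
        | ∑-map (𝟙 ∘ all p) (x ∷_) (combinations k xs)
        | count-all-combinations p (suc k) xs
  with p x
... | true rewrite count-all-combinations p k xs = nCk+nC[k+1]≡[n+1]C[k+1] (count p xs) k
... | false = cong (_+ count p xs C suc k) (∑-zero (combinations k xs) (λ _ → refl))

∩==ˢ⇒⊆ᵇ : ∀ {n} (t a b : Subset n) → ((a ∩ b) ==ˢ t) ≡ true → ((t ⊆ᵇ a) ≡ true) × ((t ⊆ᵇ b) ≡ true)
∩==ˢ⇒⊆ᵇ t a b a∩b==t rewrite sym (==ˢ⇒≡ (a ∩ b) t a∩b==t) = ∩-⊆ᵇˡ a b , ∩-⊆ᵇʳ a b

⊆ᵇ⇒∩==ˢ : ∀ {n} (t a b : Subset n) → (t ⊆ᵇ a) ≡ true → (t ⊆ᵇ b) ≡ true →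
          ∣ a ∣ ≡ suc ∣ t ∣ → ∣ b ∣ ≡ suc ∣ t ∣ → a ≢ b → ((a ∩ b) ==ˢ t) ≡ true
⊆ᵇ⇒∩==ˢ t a b t⊆a t⊆b ∣a∣ ∣b∣ a≢b with ∣ a ∩ b ∣ ≤? ∣ t ∣
... | yes small = subst (λ z → (z ==ˢ t) ≡ true) (⊆ᵇ∧∣≥∣⇒≡ t (a ∩ b) (⊆ᵇ-∩ t a b t⊆a t⊆b) small) (==ˢ-refl t)
... | no large = ⊥-elim (a≢b (trans (sym (a∩b≡ a (∩-⊆ᵇˡ a b) ∣a∣)) (a∩b≡ b (∩-⊆ᵇʳ a b) ∣b∣)))
  where
  a∩b≡ : ∀ c → ((a ∩ b) ⊆ᵇ c) ≡ true → ∣ c ∣ ≡ suc ∣ t ∣ → a ∩ b ≡ c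
  a∩b≡ c a∩b⊆c ∣c∣ = ⊆ᵇ∧∣≥∣⇒≡ (a ∩ b) c a∩b⊆c (subst (_≤ ∣ a ∩ b ∣) (sym ∣c∣) (≰⇒> large))

module _ {n : ℕ} (t : Subset n) where

  MeetIn : Subset n → Subset n → Bool
  MeetIn a b = (a ∩ b) ==ˢ t

  allPairs-MeetIn⇒all-⊇ : ∀ es → 2 ≤ length es → allPairs MeetIn es ≡ true → all (t ⊆ᵇ_) es ≡ true
  allPairs-MeetIn⇒all-⊇ (a ∷ []) (s≤s ()) _
  allPairs-MeetIn⇒all-⊇ (a ∷ b ∷ es) _ pairs = ∧-intro t⊆a (others (b ∷ es) (∧-conicalˡ _ _ pairs))
    where
    t⊆a = proj₁ (∩==ˢ⇒⊆ᵇ t a b (∧-conicalˡ _ _ (∧-conicalˡ _ _ pairs)))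
    others : ∀ cs → all (MeetIn a) cs ≡ true → all (t ⊆ᵇ_) cs ≡ true
    others [] _ = refl
    others (c ∷ cs) meets = ∧-intro (proj₂ (∩==ˢ⇒⊆ᵇ t a c (∧-conicalˡ _ _ meets))) (others cs (∧-conicalʳ _ _ meets))

  all-⊇⇒allPairs-MeetIn : ∀ es → All (λ e → ∣ e ∣ ≡ suc ∣ t ∣) es → Unique es →
                          all (t ⊆ᵇ_) es ≡ true → allPairs MeetIn es ≡ true
  all-⊇⇒allPairs-MeetIn [] _ _ _ = refl
  all-⊇⇒allPairs-MeetIn (a ∷ es) (∣a∣ ∷ sizes) (a∉es ∷ unique) t⊆all =
    ∧-intro (row es sizes a∉es (∧-conicalʳ _ _ t⊆all)) (all-⊇⇒allPairs-MeetIn es sizes unique (∧-conicalʳ _ _ t⊆all))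
    where
    row : ∀ cs → All (λ e → ∣ e ∣ ≡ suc ∣ t ∣) cs → All (a ≢_) cs → all (t ⊆ᵇ_) cs ≡ true → all (MeetIn a) cs ≡ true
    row [] _ _ _ = refl
    row (c ∷ cs) (∣c∣ ∷ sizes′) (a≢c ∷ a∉cs) t⊆cs =
      ∧-intro (⊆ᵇ⇒∩==ˢ t a c (∧-conicalˡ _ _ t⊆all) (∧-conicalˡ _ _ t⊆cs) ∣a∣ ∣c∣ a≢c)
              (row cs sizes′ a∉cs (∧-conicalʳ _ _ t⊆cs))

  allPairs-MeetIn≡all-⊇ : ∀ es → 2 ≤ length es → All (λ e → ∣ e ∣ ≡ suc ∣ t ∣) es → Unique es →
                          allPairs MeetIn es ≡ all (t ⊆ᵇ_) es
  allPairs-MeetIn≡all-⊇ es 2≤∣es∣ sizes unique = ⇔→≡ (mk⇔ (allPairs-MeetIn⇒all-⊇ es 2≤∣es∣)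
                                                           (all-⊇⇒allPairs-MeetIn es sizes unique))

IsKernel : ∀ {n} → ℕ → List (Subset n) → Subset n → Bool
IsKernel r es t = (∣ t ∣ ≡ᵇ r ∸ 1) ∧ allPairs (MeetIn t) es

kernel-unique : ∀ {n} r (es : List (Subset n)) → 2 ≤ length es → ∀ t t′ →
                IsKernel r es t ≡ true → IsKernel r es t′ ≡ true → t ≡ t′
kernel-unique r (a ∷ []) (s≤s ()) t t′ _ _
kernel-unique r (a ∷ b ∷ es) _ t t′ t-kernel t′-kernel = trans (sym (meet t t-kernel)) (meet t′ t′-kernel)
  where
  meet : ∀ u → IsKernel r (a ∷ b ∷ es) u ≡ true → a ∩ b ≡ u
  meet u u-kernel = ==ˢ⇒≡ (a ∩ b) u (∧-conicalˡ (MeetIn u a b) _ (∧-conicalˡ (all (MeetIn u a) (b ∷ es)) _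
                      (∧-conicalʳ (∣ u ∣ ≡ᵇ r ∸ 1) _ u-kernel)))

degree : ∀ {n} → Hypergraph n → Subset n → ℕ
degree {n} H t = count (λ e → H e ∧ (t ⊆ᵇ e)) (allSubsets n)

starsAt : ∀ {n} → ℕ → ℕ → Hypergraph n → Subset n → ℕ
starsAt k r H t = if ∣ t ∣ ≡ᵇ r ∸ 1 then degree H t C k else 0

module _ {n} k r (H : Hypergraph n) (2≤k : 2 ≤ k) (1≤r : 1 ≤ r) (uniform : Uniform r H) where

  private
    stars : List (List (Subset n))
    stars = combinations k (edges H)

    CopyOfEdges : List (Subset n) → Set
    CopyOfEdges es = (length es ≡ k) × All (λ e → ∣ e ∣ ≡ r) es × Unique es

    copies : All CopyOfEdges stars
    copies = All.zipWith (λ (len , rest) → len , rest)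
      (combinations-length k (edges H) ,
       All.zipWith (λ (sizes , unique) → sizes , unique)
         (combinations-All k (All.map (uniform _) (All.all-filter (λ e → H e Bool.≟ true) (allSubsets n))) ,
          combinations-unique k (Unique.filter⁺ (λ e → H e Bool.≟ true) (allSubsets-unique n))))

    2≤length : ∀ {es} → CopyOfEdges es → 2 ≤ length es
    2≤length (len , _) = subst (2 ≤_) (sym len) 2≤k

    isStar≡count-kernels : ∀ {es} → CopyOfEdges es → 𝟙 (isStar r es) ≡ count (IsKernel r es) (allSubsets n)
    isStar≡count-kernels {es} copy = sym (count≡𝟙-any (IsKernel r es)
      (AllPairs.map (λ t≢t′ t-kernel → ¬-not (λ t′-kernel → t≢t′ (kernel-unique r es (2≤length copy) _ _ t-kernel t′-kernel)))
                    (allSubsets-unique n)))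

    count-kernel≡starsAt : ∀ t → count (λ es → IsKernel r es t) stars ≡ starsAt k r H t
    count-kernel≡starsAt t with ∣ t ∣ ≡ᵇ r ∸ 1 in ∣t∣≡r-1
    ... | false = ∑-zero stars (λ _ → refl)
    ... | true = begin
      count (allPairs (MeetIn t)) stars ≡⟨ ∑-congᴬ (All.map allPairs≡all copies) ⟩
      count (all (t ⊆ᵇ_)) stars          ≡⟨ count-all-combinations (t ⊆ᵇ_) k (edges H) ⟩
      count (t ⊆ᵇ_) (edges H) C k        ≡⟨ cong (_C k) (count-filter (t ⊆ᵇ_) H (allSubsets n)) ⟩
      degree H t C k                     ∎
      where
      open ≡-Reasoning
      r≡1+∣t∣ : r ≡ suc ∣ t ∣
      r≡1+∣t∣ = trans (sym (suc-pred r {{>-nonZero 1≤r}})) (cong suc (sym (≡ᵇ-sound ∣t∣≡r-1)))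
      allPairs≡all : ∀ {es} → CopyOfEdges es → 𝟙 (allPairs (MeetIn t) es) ≡ 𝟙 (all (t ⊆ᵇ_) es)
      allPairs≡all {es} copy@(_ , sizes , unique) =
        cong 𝟙 (allPairs-MeetIn≡all-⊇ t es (2≤length copy) (All.map (λ ∣e∣ → trans ∣e∣ r≡1+∣t∣) sizes) unique)

  NStar≡∑starsAt : NStar k r H ≡ ∑ (starsAt k r H) (allSubsets n)
  NStar≡∑starsAt = begin
    NStar k r H                                                    ≡⟨ length-filter≡count (isStar r) stars ⟩
    count (isStar r) stars                                         ≡⟨ ∑-congᴬ (All.map isStar≡count-kernels copies) ⟩
    ∑ (λ es → count (IsKernel r es) (allSubsets n)) stars          ≡⟨ ∑-comm (λ es t → 𝟙 (IsKernel r es t)) stars (allSubsets n) ⟩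
    ∑ (λ t → count (λ es → IsKernel r es t) stars) (allSubsets n)  ≡⟨ ∑-cong (allSubsets n) count-kernel≡starsAt ⟩
    ∑ (starsAt k r H) (allSubsets n)                               ∎
    where open ≡-Reasoning

NStar-cong : ∀ {n} k r {H G : Hypergraph n} → H ≐ G → NStar k r H ≡ NStar k r G
NStar-cong {n} k r {H} {G} H≐G =
  cong (λ es → length (filter (λ s → isStar r s Bool.≟ true) (combinations k es)))
       (filter-≐ (λ e → H e Bool.≟ true) (λ e → G e Bool.≟ true)
                 ((λ {e} He → trans (sym (H≐G e)) He) , (λ {e} Ge → trans (H≐G e) Ge)) (allSubsets n))

module _ {n : ℕ} (k r : ℕ) {H G : Hypergraph n} (H⊆G : ∀ e → H e ≡ true → G e ≡ true) where

  private
    𝟙-edge≤ : ∀ t e → 𝟙 (H e ∧ (t ⊆ᵇ e)) ≤ 𝟙 (G e ∧ (t ⊆ᵇ e))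
    𝟙-edge≤ t e with H e in He
    ... | false = z≤n
    ... | true rewrite H⊆G e He = ≤-refl

  starsAt-mono : ∀ t → starsAt k r H t ≤ starsAt k r G t
  starsAt-mono t with ∣ t ∣ ≡ᵇ r ∸ 1
  ... | false = z≤n
  ... | true = C-monoˡ-≤ k (∑-mono-≤ (allSubsets n) (𝟙-edge≤ t))

  module _ (2≤k : 2 ≤ k) (1≤r : 1 ≤ r) (G-uniform : Uniform r G) where

    private
      H-uniform : Uniform r H
      H-uniform e He = G-uniform e (H⊆G e He)

    NStar-mono-≤ : NStar k r H ≤ NStar k r G
    NStar-mono-≤ = subst₂ _≤_ (sym (NStar≡∑starsAt k r H 2≤k 1≤r H-uniform)) (sym (NStar≡∑starsAt k r G 2≤k 1≤r G-uniform))
                     (∑-mono-≤ (allSubsets n) starsAt-mono)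

    NStar-mono-< : ∀ {e t} → G e ≡ true → H e ≡ false → (t ⊆ᵇ e) ≡ true → ∣ t ∣ ≡ r ∸ 1 → k ≤ degree G t →
                   NStar k r H < NStar k r G
    NStar-mono-< {e} {t} Ge He t⊆e ∣t∣ k≤deg =
      subst₂ _<_ (sym (NStar≡∑starsAt k r H 2≤k 1≤r H-uniform)) (sym (NStar≡∑starsAt k r G 2≤k 1≤r G-uniform))
        (∑-mono-< (allSubsets n) starsAt-mono (∈-allSubsets t) stars-at-t)
      where
      degree< : degree H t < degree G t
      degree< = ∑-mono-< (allSubsets n) (𝟙-edge≤ t) (∈-allSubsets e) e-counts
        where
        e-counts : 𝟙 (H e ∧ (t ⊆ᵇ e)) < 𝟙 (G e ∧ (t ⊆ᵇ e))
        e-counts rewrite He | Ge | t⊆e = s≤s z≤n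
      stars-at-t : starsAt k r H t < starsAt k r G t
      stars-at-t rewrite ∣t∣ | ≡ᵇ-refl (r ∸ 1) = C-monoˡ-< (≤-trans (s≤s z≤n) 2≤k) degree< k≤deg

-- Shifted families are closed under moving points down

exchange : ∀ {n} → Subset n → Fin n → Fin n → Subset n
exchange e x y = (e [ x ]≔ outside) [ y ]≔ inside

ShiftsTo : ∀ {n} → Subset n → Subset n → Set
ShiftsTo {n} e f = ∀ (x y : Fin n) → lookup e x ≡ true → lookup f x ≡ false →
                   lookup f y ≡ true → lookup e y ≡ false → toℕ y < toℕ x

module Exchange {n} {e f : Subset n} {x y : Fin n}
         (ex : lookup e x ≡ true) (fx : lookup f x ≡ false) (fy : lookup f y ≡ true) (ey : lookup e y ≡ false) where

  private
    e₁ = e [ x ]≔ outside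

    x≢y : x ≢ y
    x≢y refl = false≢true (trans (sym fx) fy)

    e₁y : lookup e₁ y ≡ false
    e₁y = trans (lookup∘update′ (x≢y ∘ sym) e false) ey

    lookup-exchange : ∀ u → u ≢ x → u ≢ y → lookup (exchange e x y) u ≡ lookup e u
    lookup-exchange u u≢x u≢y = trans (lookup∘update′ u≢y e₁ true) (lookup∘update′ u≢x e false)

  ∣exchange∣ : ∣ exchange e x y ∣ ≡ ∣ e ∣
  ∣exchange∣ = begin
    ∣ exchange e x y ∣      ≡⟨ +-identityʳ _ ⟨
    ∣ exchange e x y ∣ + 0  ≡⟨ subst (λ b → ∣ exchange e x y ∣ + 𝟙 b ≡ ∣ e₁ ∣ + 1) e₁y (∣∣-update e₁ y true) ⟩
    ∣ e₁ ∣ + 1              ≡⟨ subst (λ b → ∣ e₁ ∣ + 𝟙 b ≡ ∣ e ∣ + 0) ex (∣∣-update e x false) ⟩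
    ∣ e ∣ + 0               ≡⟨ +-identityʳ _ ⟩
    ∣ e ∣                   ∎
    where open ≡-Reasoning

  ∣exchange─∣ : suc ∣ exchange e x y ─ f ∣ ≡ ∣ e ─ f ∣
  ∣exchange─∣ = begin
    suc ∣ exchange e x y ─ f ∣      ≡⟨ +-comm 1 _ ⟩
    ∣ exchange e x y ─ f ∣ + 1      ≡⟨ cong (_+ 1) (+-cancelʳ-≡ 0 _ _
                                         (subst₂ (λ a b → ∣ exchange e x y ─ f ∣ + 𝟙 (a ∧ not b) ≡ ∣ e₁ ─ f ∣ + 𝟙 (not b))
                                                 e₁y fy (∣─∣-update e₁ f y true))) ⟩
    ∣ e₁ ─ f ∣ + 1                  ≡⟨ subst₂ (λ a b → ∣ e₁ ─ f ∣ + 𝟙 (a ∧ not b) ≡ ∣ e ─ f ∣ + 0) ex fx (∣─∣-update e f x false) ⟩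
    ∣ e ─ f ∣ + 0                   ≡⟨ +-identityʳ _ ⟩
    ∣ e ─ f ∣                       ∎
    where open ≡-Reasoning

  exchange-ShiftsTo : ShiftsTo e f → ShiftsTo (exchange e x y) f
  exchange-ShiftsTo e⇝f u v e′u fu fv e′v = e⇝f u v eu fu fv ev
    where
    u≢y : u ≢ y
    u≢y refl = false≢true (trans (sym fu) fy)
    u≢x : u ≢ x
    u≢x refl = false≢true (trans (sym (trans (lookup∘update′ x≢y e₁ true) (lookup∘update x e false))) e′u)
    eu : lookup e u ≡ true
    eu = trans (sym (lookup-exchange u u≢x u≢y)) e′u
    ev : lookup e v ≡ false
    ev with v Fin.≟ y | v Fin.≟ x
    ... | yes refl | _ = ey
    ... | no _ | yes refl = ⊥-elim (false≢true (trans (sym fx) fv))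
    ... | no v≢y | no v≢x = trans (sym (lookup-exchange v v≢x v≢y)) e′v

module _ {n} {H : Hypergraph n} (shifted : Shifted H) where

  shifted-exchange : ∀ {e} x y → H e ≡ true → lookup e x ≡ true → lookup e y ≡ false → toℕ y < toℕ x →
                     H (exchange e x y) ≡ true
  shifted-exchange {e} x y He ex ey y<x with H (exchange e x y) in He′
  ... | true = refl
  ... | false = trans (sym He′) (subst (λ f → H f ≡ true) Sᵧₓe≡e′ (Equivalence.to (shifted y x y<x _) (e , He , refl)))
    where
    Sᵧₓe≡e′ : shiftEdge y x H e ≡ exchange e x y
    Sᵧₓe≡e′ rewrite ex | ey | He′ = refl

  -- Induction on ∣ e ─ f ∣: exchange a point of e ─ f for a smaller point of f ─ e.
  shifted-closed : ∀ {e f} → H e ≡ true → ∣ e ∣ ≡ ∣ f ∣ → ShiftsTo e f → H f ≡ true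
  shifted-closed {e} {f} He ∣e∣≡∣f∣ e⇝f = go ∣ e ─ f ∣ e refl He ∣e∣≡∣f∣ e⇝f
    where
    go : ∀ d e → ∣ e ─ f ∣ ≡ d → H e ≡ true → ∣ e ∣ ≡ ∣ f ∣ → ShiftsTo e f → H f ≡ true
    go zero e e─f He ∣e∣≡∣f∣ _ =
      subst (λ g → H g ≡ true) (∣─∣≡0⇒≡ e f e─f (trans (sym (∣p─q∣≡∣q─p∣ e f ∣e∣≡∣f∣)) e─f)) He
    go (suc d) e e─f He ∣e∣≡∣f∣ e⇝f
      with ∣─∣≢0⇒witness e f e─f | ∣─∣≢0⇒witness f e (trans (sym (∣p─q∣≡∣q─p∣ e f ∣e∣≡∣f∣)) e─f)
    ... | x , ex , fx | y , fy , ey =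
      go d (exchange e x y) (suc-injective (trans ∣exchange─∣ e─f)) (shifted-exchange x y He ex ey (e⇝f x y ex fx fy ey))
         (trans ∣exchange∣ ∣e∣≡∣f∣) (exchange-ShiftsTo e⇝f)
      where open Exchange {e = e} {f = f} {x = x} {y = y} ex fx fy ey

-- Disjoint edges in shifted families

⟦_⟧ : ∀ {n} → (ℕ → Bool) → Subset n
⟦ P ⟧ = tabulate (P ∘ toℕ)

lookup-⟦⟧ : ∀ {n} (P : ℕ → Bool) (v : Fin n) → lookup ⟦ P ⟧ v ≡ P (toℕ v)
lookup-⟦⟧ P = lookup∘tabulate (P ∘ toℕ)

countℕ : (ℕ → Bool) → ℕ → ℕ
countℕ P zero = 0
countℕ P (suc n) = 𝟙 (P 0) + countℕ (P ∘ suc) n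

∣⟦⟧∣ : ∀ n (P : ℕ → Bool) → ∣ ⟦_⟧ {n} P ∣ ≡ countℕ P n
∣⟦⟧∣ zero P = refl
∣⟦⟧∣ (suc n) P with P 0
... | true = cong suc (∣⟦⟧∣ n (P ∘ suc))
... | false = ∣⟦⟧∣ n (P ∘ suc)

countℕ-++ : ∀ a b (P : ℕ → Bool) → countℕ P (a + b) ≡ countℕ P a + countℕ (λ v → P (a + v)) b
countℕ-++ zero b P = refl
countℕ-++ (suc a) b P = trans (cong (𝟙 (P 0) +_) (countℕ-++ a b (P ∘ suc))) (sym (+-assoc (𝟙 (P 0)) _ _))

countℕ-const : ∀ b n (P : ℕ → Bool) → (∀ v → v < n → P v ≡ b) → countℕ P n ≡ 𝟙 b * n
countℕ-const b zero P _ = sym (*-zeroʳ (𝟙 b))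
countℕ-const b (suc n) P P≡b rewrite P≡b 0 z<s | countℕ-const b n (P ∘ suc) (λ v v<n → P≡b (suc v) (s<s v<n)) =
  sym (*-suc (𝟙 b) n)

countℕ-∨ : ∀ n (P Q : ℕ → Bool) → (∀ v → P v ∧ Q v ≡ false) → countℕ (λ v → P v ∨ Q v) n ≡ countℕ P n + countℕ Q n
countℕ-∨ zero P Q _ = refl
countℕ-∨ (suc n) P Q disjoint rewrite countℕ-∨ n (P ∘ suc) (Q ∘ suc) (disjoint ∘ suc) with P 0 | Q 0 | disjoint 0
... | true | false | _ = refl
... | false | true | _ = sym (+-suc (countℕ (P ∘ suc) n) _)
... | false | false | _ = refl

countℕ-window : ∀ n b l (P : ℕ → Bool) → b + l ≤ n → (∀ v → v < b → P v ≡ false) →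
                (∀ v → b ≤ v → v < b + l → P v ≡ true) → (∀ v → b + l ≤ v → P v ≡ false) → countℕ P n ≡ l
countℕ-window n b l P b+l≤n before within after = begin
  countℕ P n                                                       ≡⟨ cong (countℕ P) (m+[n∸m]≡n b+l≤n) ⟨
  countℕ P (b + l + (n ∸ (b + l)))                                 ≡⟨ countℕ-++ (b + l) _ P ⟩
  countℕ P (b + l) + countℕ (λ v → P (b + l + v)) (n ∸ (b + l))   ≡⟨ cong₂ _+_ (countℕ-++ b l P)
                                                                        (countℕ-const false (n ∸ (b + l)) _ (λ v _ → after _ (m≤m+n (b + l) v))) ⟩
  countℕ P b + countℕ (λ v → P (b + v)) l + 0                      ≡⟨ cong (λ z → z + countℕ (λ v → P (b + v)) l + 0)
                                                                        (countℕ-const false b P before) ⟩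
  countℕ (λ v → P (b + v)) l + 0                                   ≡⟨ +-identityʳ _ ⟩
  countℕ (λ v → P (b + v)) l                                       ≡⟨ countℕ-const true l _ (λ v v<l → within _ (m≤m+n b v) (+-monoʳ-< b v<l)) ⟩
  1 * l                                                            ≡⟨ *-identityˡ l ⟩
  l                                                                ∎
  where open ≡-Reasoning

interval : ℕ → ℕ → ℕ → Bool
interval b l v = (b ≤ᵇ v) ∧ (v <ᵇ b + l)

interval-sound : ∀ {b l v} → interval b l v ≡ true → b ≤ v × v < b + l
interval-sound {b} {l} {v} v∈ = ≤ᵇ-sound (∧-conicalˡ (b ≤ᵇ v) _ v∈) , <ᵇ-sound (∧-conicalʳ (b ≤ᵇ v) _ v∈)

interval-complete : ∀ {b l v} → b ≤ v → v < b + l → interval b l v ≡ true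
interval-complete b≤v v<b+l = ∧-intro (≤ᵇ-complete b≤v) (<ᵇ-complete v<b+l)

interval-before : ∀ {b l v} → v < b → interval b l v ≡ false
interval-before {b} {l} {v} v<b rewrite ≤ᵇ-false {b} {v} (<⇒≱ v<b) = refl

interval-after : ∀ {b l v} → b + l ≤ v → interval b l v ≡ false
interval-after {b} {l} {v} b+l≤v rewrite <ᵇ-false {v} {b + l} (≤⇒≯ b+l≤v) with b ≤ᵇ v
... | true = refl
... | false = refl

countℕ-interval : ∀ n b l → b + l ≤ n → countℕ (interval b l) n ≡ l
countℕ-interval n b l b+l≤n = countℕ-window n b l (interval b l) b+l≤n
  (λ _ → interval-before {b} {l}) (λ _ → interval-complete {b} {l}) (λ _ → interval-after {b} {l})

countℕ-point : ∀ n a → a < n → countℕ (_≡ᵇ a) n ≡ 1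
countℕ-point n a a<n = countℕ-window n a 1 (_≡ᵇ a) (subst (_≤ n) (+-comm 1 a) a<n)
  (λ v v<a → ≡ᵇ-false (<⇒≢ v<a))
  (λ v a≤v v<a+1 → subst (λ w → (w ≡ᵇ a) ≡ true) (≤-antisym a≤v (m<1+n⇒m≤n (subst (v <_) (+-comm a 1) v<a+1))) (≡ᵇ-refl a))
  (λ v a+1≤v → ≡ᵇ-false (>⇒≢ (subst (_≤ v) (+-comm a 1) a+1≤v)))

disjoint⇒∩≡⊥ : ∀ {n} (p q : Subset n) → (∀ v → lookup p v ≡ true → lookup q v ≡ true → ⊥) → p ∩ q ≡ Subset.⊥
disjoint⇒∩≡⊥ [] [] _ = refl
disjoint⇒∩≡⊥ (true ∷ p) (true ∷ q) disjoint = ⊥-elim (disjoint fzero refl refl)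
disjoint⇒∩≡⊥ (true ∷ p) (false ∷ q) disjoint = cong (false ∷_) (disjoint⇒∩≡⊥ p q (disjoint ∘ fsuc))
disjoint⇒∩≡⊥ (false ∷ p) (b ∷ q) disjoint = cong (false ∷_) (disjoint⇒∩≡⊥ p q (disjoint ∘ fsuc))

_◁_ : ℕ → (ℕ → Bool) → ℕ → Bool
(a ◁ I) v = (v ≡ᵇ a) ∨ I v

◁-sound : ∀ {a I v} → (a ◁ I) v ≡ true → v ≡ a ⊎ I v ≡ true
◁-sound {a} {I} {v} v∈ with v ≡ᵇ a in v≡a
... | true = inj₁ (≡ᵇ-sound v≡a)
... | false = inj₂ v∈

◁-point : ∀ a I → (a ◁ I) a ≡ true
◁-point a I rewrite ≡ᵇ-refl a = refl

countℕ-◁ : ∀ n a I → a < n → I a ≡ false → countℕ (a ◁ I) n ≡ suc (countℕ I n)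
countℕ-◁ n a I a<n Ia = trans (countℕ-∨ n (_≡ᵇ a) I disjoint) (cong (_+ countℕ I n) (countℕ-point n a a<n))
  where
  disjoint : ∀ v → (v ≡ᵇ a) ∧ I v ≡ false
  disjoint v with v ≡ᵇ a in v≡a
  ... | true = subst (λ w → I w ≡ false) (sym (≡ᵇ-sound v≡a)) Ia
  ... | false = refl

module Petals (base l : ℕ) where

  block : ℕ → ℕ → Bool
  block m = interval (base + m * l) l

  petal : ∀ {n} → ℕ → Subset n
  petal m = ⟦ m ◁ block m ⟧

  block-end≤start : ∀ {m m′} → m < m′ → base + m * l + l ≤ base + m′ * l
  block-end≤start {m} {m′} m<m′ = subst (_≤ base + m′ * l) (sym (+-assoc base (m * l) l))
    (+-monoʳ-≤ base (subst (_≤ m′ * l) (+-comm l (m * l)) (*-monoˡ-≤ l m<m′)))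

  blocks-disjoint : ∀ {m m′ v} → base + m * l ≤ v → v < base + m * l + l →
                    base + m′ * l ≤ v → v < base + m′ * l + l → m ≡ m′
  blocks-disjoint {m} {m′} start≤v v<end start′≤v v<end′ with <-cmp m m′
  ... | tri≈ _ m≡m′ _ = m≡m′
  ... | tri< m<m′ _ _ = ⊥-elim (<-irrefl refl (≤-trans v<end (≤-trans (block-end≤start m<m′) start′≤v)))
  ... | tri> _ _ m>m′ = ⊥-elim (<-irrefl refl (≤-trans v<end′ (≤-trans (block-end≤start m>m′) start≤v)))

  ∈-petal : ∀ {n} m (v : Fin n) → lookup (petal m) v ≡ true →
            toℕ v ≡ m ⊎ (base + m * l ≤ toℕ v × toℕ v < base + m * l + l)
  ∈-petal m v v∈ with ◁-sound {m} {block m} (trans (sym (lookup-⟦⟧ (m ◁ block m) v)) v∈)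
  ... | inj₁ v≡m = inj₁ v≡m
  ... | inj₂ v∈block = inj₂ (interval-sound {base + m * l} {l} v∈block)

  module _ {n} {H : Hypergraph n} {σ} (σ≤base : σ ≤ base) (petal∈H : ∀ m → m < σ → H (petal {n} m) ≡ true)
           {X : Subset n} (X∈H : H X ≡ true)
           (X-avoids : ∀ v → lookup X v ≡ true → σ ≤ toℕ v × (toℕ v < base ⊎ base + σ * l ≤ toℕ v)) where

    private
      point-not-in-block : ∀ {m m′ v} → m < σ → v ≡ m → base + m′ * l ≤ v → ⊥
      point-not-in-block {m} {m′} m<σ refl start≤v =
        <-irrefl refl (≤-trans m<σ (≤-trans σ≤base (≤-trans (m≤m+n base (m′ * l)) start≤v)))

      petals-disjoint : ∀ {m m′} → m < σ → m′ < σ → m ≢ m′ →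
                        ∀ v → lookup (petal {n} m) v ≡ true → lookup (petal {n} m′) v ≡ true → ⊥
      petals-disjoint {m} {m′} m<σ m′<σ m≢m′ v v∈m v∈m′ with ∈-petal m v v∈m | ∈-petal m′ v v∈m′
      ... | inj₁ v≡m | inj₁ v≡m′ = m≢m′ (trans (sym v≡m) v≡m′)
      ... | inj₁ v≡m | inj₂ (start′≤v , _) = point-not-in-block {m′ = m′} m<σ v≡m start′≤v
      ... | inj₂ (start≤v , _) | inj₁ v≡m′ = point-not-in-block {m′ = m} m′<σ v≡m′ start≤v
      ... | inj₂ (start≤v , v<end) | inj₂ (start′≤v , v<end′) = m≢m′ (blocks-disjoint start≤v v<end start′≤v v<end′)

      petal-X-disjoint : ∀ {m} → m < σ → ∀ v → lookup (petal {n} m) v ≡ true → lookup X v ≡ true → ⊥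
      petal-X-disjoint {m} m<σ v v∈m v∈X with ∈-petal m v v∈m | X-avoids v v∈X
      ... | inj₁ refl | σ≤v , _ = <-irrefl refl (≤-trans m<σ σ≤v)
      ... | inj₂ (start≤v , _) | _ , inj₁ v<base = <-irrefl refl (≤-trans v<base (≤-trans (m≤m+n base (m * l)) start≤v))
      ... | inj₂ (_ , v<end) | _ , inj₂ blocks≤v = <-irrefl refl (≤-trans v<end (≤-trans (block-end≤start m<σ) blocks≤v))

      edge : Fin (suc σ) → Subset n
      edge i = if toℕ i <ᵇ σ then petal (toℕ i) else X

      edge∈H : ∀ i → H (edge i) ≡ true
      edge∈H i with toℕ i <ᵇ σ in i<σ
      ... | true = petal∈H (toℕ i) (<ᵇ-sound i<σ)
      ... | false = X∈H

      edges-disjoint : ∀ i j → i ≢ j → edge i ∩ edge j ≡ Subset.⊥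
      edges-disjoint i j i≢j with toℕ i <ᵇ σ in i<σ | toℕ j <ᵇ σ in j<σ
      ... | true | true = disjoint⇒∩≡⊥ _ _ (petals-disjoint (<ᵇ-sound i<σ) (<ᵇ-sound j<σ) (i≢j ∘ toℕ-injective))
      ... | true | false = disjoint⇒∩≡⊥ _ _ (petal-X-disjoint (<ᵇ-sound i<σ))
      ... | false | true = disjoint⇒∩≡⊥ _ _ (λ v v∈X v∈j → petal-X-disjoint (<ᵇ-sound j<σ) v v∈j v∈X)
      ... | false | false = ⊥-elim (i≢j (toℕ-injective (trans (last i i<σ) (sym (last j j<σ)))))
        where
        last : ∀ (k : Fin (suc σ)) → (toℕ k <ᵇ σ) ≡ false → toℕ k ≡ σ
        last k k≮σ = ≤-antisym (m<1+n⇒m≤n (toℕ<n k)) (≮⇒≥ (λ k<σ → false≢true (trans (sym k≮σ) (<ᵇ-complete k<σ))))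

    petals+X⇒disjointEdges : HasDisjointEdges H (suc σ)
    petals+X⇒disjointEdges = edge , edge∈H , edges-disjoint

-- Room for the σ + 1 points [0, σ] and two runs of σ + 1 blocks of length l.
coreSize : ℕ → ℕ → ℕ
coreSize σ l = suc σ + suc σ * l + suc σ * l

module _ {n} {H : Hypergraph n} (shifted : Shifted H) where

  shifted-◁-compress : ∀ {e l a c} → H e ≡ true → ∣ e ∣ ≡ suc l → a < c → c ≤ n →
                    (∀ v → lookup e v ≡ true → toℕ v < c → toℕ v ≡ a) →
                    ∀ I → (∀ v → I v ≡ true → v < c) → I a ≡ false → countℕ I n ≡ l →
                    H ⟦ a ◁ I ⟧ ≡ true
  shifted-◁-compress {e} {l} {a} {c} He ∣e∣ a<c c≤n e-below-c I I<c Ia ∣I∣ = shifted-closed shifted He ∣e∣≡∣f∣ e⇝f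
    where
    f = ⟦_⟧ {n} (a ◁ I)
    ∣e∣≡∣f∣ : ∣ e ∣ ≡ ∣ f ∣
    ∣e∣≡∣f∣ = trans ∣e∣ (sym (trans (∣⟦⟧∣ n (a ◁ I)) (trans (countℕ-◁ n a I (≤-trans a<c c≤n) Ia) (cong suc ∣I∣))))
    f<c : ∀ y → lookup f y ≡ true → toℕ y < c
    f<c y fy with ◁-sound {a} {I} (trans (sym (lookup-⟦⟧ (a ◁ I) y)) fy)
    ... | inj₁ y≡a = subst (_< c) (sym y≡a) a<c
    ... | inj₂ Iy = I<c (toℕ y) Iy
    e⇝f : ShiftsTo e f
    e⇝f x y ex fx fy _ = ≤-trans (f<c y fy) (≮⇒≥ x≮c)
      where
      x≮c : toℕ x ≮ c
      x≮c x<c = false≢true (trans (sym fx) (trans (lookup-⟦⟧ (a ◁ I) x)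
                  (subst (λ v → (a ◁ I) v ≡ true) (sym (e-below-c x ex x<c)) (◁-point a I))))

  shifted-◁-lower : ∀ {a m I} → m ≤ a → a < n → I m ≡ false → I a ≡ false → H ⟦ a ◁ I ⟧ ≡ true → H ⟦ m ◁ I ⟧ ≡ true
  shifted-◁-lower {a} {m} {I} m≤a a<n Im Ia He = shifted-closed shifted He ∣e∣≡∣f∣ e⇝f
    where
    e = ⟦_⟧ {n} (a ◁ I)
    f = ⟦_⟧ {n} (m ◁ I)
    ∣e∣≡∣f∣ : ∣ e ∣ ≡ ∣ f ∣
    ∣e∣≡∣f∣ = begin
      ∣ e ∣              ≡⟨ ∣⟦⟧∣ n (a ◁ I) ⟩
      countℕ (a ◁ I) n   ≡⟨ countℕ-◁ n a I a<n Ia ⟩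
      suc (countℕ I n)   ≡⟨ countℕ-◁ n m I (≤-<-trans m≤a a<n) Im ⟨
      countℕ (m ◁ I) n   ≡⟨ ∣⟦⟧∣ n (m ◁ I) ⟨
      ∣ f ∣              ∎
      where open ≡-Reasoning
    only-point : ∀ b {v : Fin n} → lookup ⟦ b ◁ I ⟧ v ≡ true → I (toℕ v) ≡ false → toℕ v ≡ b
    only-point b {v} v∈ v∉I with ◁-sound {b} {I} (trans (sym (lookup-⟦⟧ (b ◁ I) v)) v∈)
    ... | inj₁ v≡b = v≡b
    ... | inj₂ Iv = ⊥-elim (false≢true (trans (sym v∉I) Iv))
    ∉◁⇒∉I : ∀ b {v : Fin n} → lookup ⟦ b ◁ I ⟧ v ≡ false → I (toℕ v) ≡ false
    ∉◁⇒∉I b {v} v∉ = ∨-conicalʳ (toℕ v ≡ᵇ b) (I (toℕ v)) (trans (sym (lookup-⟦⟧ (b ◁ I) v)) v∉)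
    e⇝f : ShiftsTo e f
    e⇝f x y ex fx fy ey = ≤∧≢⇒< (subst₂ _≤_ (sym y≡m) (sym x≡a) m≤a) y≢x
      where
      x≡a = only-point a ex (∉◁⇒∉I m fx)
      y≡m = only-point m fy (∉◁⇒∉I a ey)
      y≢x : toℕ y ≢ toℕ x
      y≢x y≡x = false≢true (trans (sym ey) (subst (λ v → lookup e v ≡ true) (toℕ-injective (sym y≡x)) ex))

  lowest-edge∈H : ∀ {σ l e} → σ + suc l ≤ n → H e ≡ true → ∣ e ∣ ≡ suc l → (∀ v → lookup e v ≡ true → σ ≤ toℕ v) →
                  H ⟦ interval σ (suc l) ⟧ ≡ true
  lowest-edge∈H {σ} {l} {e} σ+1+l≤n He ∣e∣ e≥σ = shifted-closed shifted He ∣e∣≡∣f∣ e⇝f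
    where
    f = ⟦_⟧ {n} (interval σ (suc l))
    ∣e∣≡∣f∣ : ∣ e ∣ ≡ ∣ f ∣
    ∣e∣≡∣f∣ = trans ∣e∣ (sym (trans (∣⟦⟧∣ n (interval σ (suc l))) (countℕ-interval n σ (suc l) σ+1+l≤n)))
    e⇝f : ShiftsTo e f
    e⇝f x y ex fx fy _ = ≤-trans (proj₂ (interval-sound {σ} {suc l} (trans (sym (lookup-⟦⟧ (interval σ (suc l)) y)) fy))) (≮⇒≥ x≮end)
      where
      x≮end : toℕ x ≮ σ + suc l
      x≮end x<end = false≢true (trans (sym fx) (trans (lookup-⟦⟧ (interval σ (suc l)) x)
                      (interval-complete {σ} {suc l} (e≥σ x ex) x<end)))

  module _ {l base σ c : ℕ} (σ≤base : σ ≤ base) (blocks≤c : base + σ * l ≤ c) (c≤n : c ≤ n) where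
    open Petals base l

    -- Shift e onto {a} ∪ block m inside [0, c), then replace a by m.
    petals∈H : ∀ {e a} → H e ≡ true → ∣ e ∣ ≡ suc l → (∀ v → lookup e v ≡ true → toℕ v < c → toℕ v ≡ a) →
               a < c → σ ≤ suc a → a < base ⊎ base + σ * l ≤ a → ∀ m → m < σ → H (petal m) ≡ true
    petals∈H {e} {a} He ∣e∣ e-below-c a<c σ≤1+a a-outside m m<σ =
      shifted-◁-lower m≤a (≤-trans a<c c≤n) (interval-before {base + m * l} {l} m<start) a∉block
        (shifted-◁-compress He ∣e∣ a<c c≤n e-below-c (block m) block<c a∉block
          (countℕ-interval n (base + m * l) l (≤-trans end≤blocks (≤-trans blocks≤c c≤n))))
      where
      end≤blocks : base + m * l + l ≤ base + σ * l
      end≤blocks = block-end≤start m<σ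
      block<c : ∀ v → block m v ≡ true → v < c
      block<c v v∈ = ≤-trans (proj₂ (interval-sound {base + m * l} {l} v∈)) (≤-trans end≤blocks blocks≤c)
      m≤a = m<1+n⇒m≤n (≤-trans m<σ σ≤1+a)
      m<start : m < base + m * l
      m<start = ≤-trans m<σ (≤-trans σ≤base (m≤m+n base (m * l)))
      outside⇒∉block : a < base ⊎ base + σ * l ≤ a → block m a ≡ false
      outside⇒∉block (inj₁ a<base) = interval-before {base + m * l} {l} (≤-trans a<base (m≤m+n base (m * l)))
      outside⇒∉block (inj₂ blocks≤a) = interval-after {base + m * l} {l} (≤-trans end≤blocks blocks≤a)
      a∉block = outside⇒∉block a-outside

  sparseEdge⇒disjointEdges-at : ∀ {l base σ c e a} → σ ≤ base → base + suc σ * l ≤ c → c ≤ n →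
    H e ≡ true → ∣ e ∣ ≡ suc l → (∀ v → lookup e v ≡ true → toℕ v < c → toℕ v ≡ a) →
    σ ≤ a → a < c → a < base ⊎ base + suc σ * l ≤ a → HasDisjointEdges H (suc σ)
  sparseEdge⇒disjointEdges-at {l} {base} {σ} {c} {e} {a} σ≤base blocks≤c c≤n He ∣e∣ e-below-c σ≤a a<c a-outside =
    petals+X⇒disjointEdges {H = H} σ≤base
      (petals∈H σ≤base (≤-trans first-blocks≤ blocks≤c) c≤n He ∣e∣ e-below-c a<c (m≤n⇒m≤1+n σ≤a) (outside′ a-outside))
      X∈H X-avoids
    where
    open Petals base l
    last-end≤ : base + σ * l + l ≤ base + suc σ * l
    last-end≤ = block-end≤start (n<1+n σ)
    first-blocks≤ : base + σ * l ≤ base + suc σ * l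
    first-blocks≤ = ≤-trans (m≤m+n _ l) last-end≤
    outside′ : a < base ⊎ base + suc σ * l ≤ a → a < base ⊎ base + σ * l ≤ a
    outside′ (inj₁ a<base) = inj₁ a<base
    outside′ (inj₂ blocks≤a) = inj₂ (≤-trans first-blocks≤ blocks≤a)
    a∉last : a < base ⊎ base + suc σ * l ≤ a → block σ a ≡ false
    a∉last (inj₁ a<base) = interval-before {base + σ * l} {l} (≤-trans a<base (m≤m+n base (σ * l)))
    a∉last (inj₂ blocks≤a) = interval-after {base + σ * l} {l} (≤-trans last-end≤ blocks≤a)
    X∈H : H ⟦ a ◁ block σ ⟧ ≡ true
    X∈H = shifted-◁-compress He ∣e∣ a<c c≤n e-below-c (block σ)
            (λ v v∈ → ≤-trans (proj₂ (interval-sound {base + σ * l} {l} v∈)) (≤-trans last-end≤ blocks≤c))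
            (a∉last a-outside) (countℕ-interval n (base + σ * l) l (≤-trans last-end≤ (≤-trans blocks≤c c≤n)))
    X-avoids : ∀ v → lookup ⟦ a ◁ block σ ⟧ v ≡ true → σ ≤ toℕ v × (toℕ v < base ⊎ base + σ * l ≤ toℕ v)
    X-avoids v v∈ with ◁-sound {a} {block σ} (trans (sym (lookup-⟦⟧ (a ◁ block σ) v)) v∈)
    ... | inj₁ v≡a = subst (λ w → σ ≤ w × (w < base ⊎ base + σ * l ≤ w)) (sym v≡a) (σ≤a , outside′ a-outside)
    ... | inj₂ v∈last = ≤-trans σ≤base (≤-trans (m≤m+n base (σ * l)) start≤v) , inj₂ start≤v
      where start≤v = proj₁ (interval-sound {base + σ * l} {l} v∈last)


  sparseEdge⇒disjointEdges : ∀ {σ l e} → coreSize σ l ≤ n → H e ≡ true → ∣ e ∣ ≡ suc l →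
    (∀ v → lookup e v ≡ true → σ ≤ toℕ v) →
    (∀ v w → lookup e v ≡ true → lookup e w ≡ true → toℕ v < coreSize σ l → toℕ w < coreSize σ l → v ≡ w) →
    HasDisjointEdges H (suc σ)
  sparseEdge⇒disjointEdges {σ} {l} {e} c≤n He ∣e∣ e≥σ at-most-one =
    from-core-vertex (any? (λ v → (lookup e v Bool.≟ true) ×-dec (toℕ v <? c)))
    where
    c = coreSize σ l
    b₁ = suc σ
    b₂ = b₁ + suc σ * l
    -- The blocks at base b₂ lie above a, those at base b₁ below it.
    choose-base : ∀ a → σ ≤ a → a < c → (∀ v → lookup e v ≡ true → toℕ v < c → toℕ v ≡ a) → HasDisjointEdges H (suc σ)
    choose-base a σ≤a a<c e-below-c with a <? b₂
    ... | yes a<b₂ = sparseEdge⇒disjointEdges-at {base = b₂} (≤-trans (n≤1+n σ) (m≤m+n b₁ _)) ≤-refl c≤n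
                       He ∣e∣ e-below-c σ≤a a<c (inj₁ a<b₂)
    ... | no a≮b₂ = sparseEdge⇒disjointEdges-at {base = b₁} (n≤1+n σ) (m≤m+n b₂ _) c≤n
                       He ∣e∣ e-below-c σ≤a a<c (inj₂ (≮⇒≥ a≮b₂))
    from-core-vertex : Dec (∃[ v ] (lookup e v ≡ true × toℕ v < c)) → HasDisjointEdges H (suc σ)
    from-core-vertex (yes (v₀ , ev₀ , v₀<c)) =
      choose-base (toℕ v₀) (e≥σ v₀ ev₀) v₀<c (λ v ev v<c → cong toℕ (at-most-one v v₀ ev ev₀ v<c v₀<c))
    from-core-vertex (no none) =
      choose-base σ ≤-refl (≤-trans (n<1+n σ) (≤-trans (m≤m+n b₁ _) (m≤m+n b₂ _))) (λ v ev v<c → ⊥-elim (none (v , ev , v<c)))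

  twoEdges⇒disjointEdges : ∀ {τ l e₀ e} → coreSize (suc τ) l ≤ n →
    H e₀ ≡ true → ∣ e₀ ∣ ≡ suc l → (∀ v → lookup e₀ v ≡ true → suc τ ≤ toℕ v) →
    H e ≡ true → ∣ e ∣ ≡ suc l → (∀ v → lookup e v ≡ true → toℕ v < coreSize (suc τ) l → toℕ v ≡ τ) →
    HasDisjointEdges H (suc (suc τ))
  twoEdges⇒disjointEdges {τ} {l} {e₀} {e} c≤n He₀ ∣e₀∣ e₀≥σ He ∣e∣ e-below-c =
    petals+X⇒disjointEdges {H = H} σ≤base
      (petals∈H σ≤base blocks≤c c≤n He ∣e∣ e-below-c τ<c ≤-refl (inj₁ τ<base))
      (lowest-edge∈H (≤-trans (m≤m+n base (σ * l)) (≤-trans blocks≤c c≤n)) He₀ ∣e₀∣ e₀≥σ) lowest-avoids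
    where
    σ = suc τ
    base = σ + suc l
    open Petals base l
    c = coreSize σ l
    σ≤base : σ ≤ base
    σ≤base = m≤m+n σ (suc l)
    blocks≤c : base + σ * l ≤ c
    blocks≤c = subst (_≤ c) (sym (trans (cong (_+ σ * l) (+-suc σ l)) (cong suc (+-assoc σ l (σ * l)))))
                 (m≤m+n (suc σ + suc σ * l) (suc σ * l))
    τ<base : τ < base
    τ<base = ≤-trans (n<1+n τ) σ≤base
    τ<c : τ < c
    τ<c = ≤-trans τ<base (≤-trans (m≤m+n base (σ * l)) blocks≤c)
    lowest-avoids : ∀ v → lookup ⟦ interval σ (suc l) ⟧ v ≡ true → σ ≤ toℕ v × (toℕ v < base ⊎ base + σ * l ≤ toℕ v)
    lowest-avoids v v∈ with interval-sound {σ} {suc l} (trans (sym (lookup-⟦⟧ (interval σ (suc l)) v)) v∈)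
    ... | σ≤v , v<base = σ≤v , inj₁ v<base

-- An asymptotic estimate

*-^-distrib : ∀ a b j → (a * b) ^ j ≡ a ^ j * b ^ j
*-^-distrib a b zero = refl
*-^-distrib a b (suc j) rewrite *-^-distrib a b j = rearrange a b (a ^ j) (b ^ j)
  where
  rearrange : ∀ a b x y → a * b * (x * y) ≡ a * x * (b * y)
  rearrange = solve-∀

module BinomialEstimate (c l₀ k : ℕ) (2≤k : 2 ≤ k) where

  D D′ e K₁ K₂ K threshold : ℕ
  D = suc (l₀ + k)
  D′ = c + 2 * D
  e = l₀ + k
  K₁ = 2 * D * D′ ^ suc l₀ * (c C k)
  K₂ = 2 ^ c * (2 * D) ^ l₀ * D′ ^ k
  K = K₁ + K₂
  threshold = suc K * D

  private module _ {m t : ℕ} (1≤t : 1 ≤ t) (Dt≤m : D * t ≤ m) (m≤2Dt : m ≤ 2 * D * t) where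

    c+m≤D′t : c + m ≤ D′ * t
    c+m≤D′t = subst (c + m ≤_) (distrib c t D) (+-mono-≤ (subst (_≤ c * t) (*-identityʳ c) (*-monoʳ-≤ c 1≤t)) m≤2Dt)
      where
      distrib : ∀ c t d → c * t + 2 * d * t ≡ (c + 2 * d) * t
      distrib = solve-∀

    first-term≤ : m * ((c + m) C suc l₀) * (c C k) ≤ K₁ * t ^ e
    first-term≤ = begin
      m * ((c + m) C suc l₀) * (c C k)             ≤⟨ *-monoˡ-≤ (c C k) (*-mono-≤ m≤2Dt
                                                        (≤-trans (C≤^ (c + m) (suc l₀)) (^-monoˡ-≤ (suc l₀) c+m≤D′t))) ⟩
      2 * D * t * (D′ * t) ^ suc l₀ * (c C k)        ≡⟨ cong (λ z → 2 * D * t * z * (c C k)) (*-^-distrib D′ t (suc l₀)) ⟩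
      2 * D * t * (D′ ^ suc l₀ * t ^ suc l₀) * (c C k) ≡⟨ rearrange D t (D′ ^ suc l₀) (t ^ suc l₀) (c C k) ⟩
      K₁ * t ^ suc (suc l₀)                         ≤⟨ *-monoʳ-≤ K₁ (^-monoʳ-≤ t {{>-nonZero 1≤t}} 2+l₀≤e) ⟩
      K₁ * t ^ e                                    ∎
      where
      open ≤-Reasoning
      rearrange : ∀ d t x y z → 2 * d * t * (x * y) * z ≡ 2 * d * x * z * (t * y)
      rearrange = solve-∀
      2+l₀≤e : 2 + l₀ ≤ e
      2+l₀≤e = subst (2 + l₀ ≤_) (+-comm k l₀) (+-monoˡ-≤ l₀ 2≤k)

    second-term≤ : 2 ^ c * m ^ l₀ * ((c + m) C k) ≤ K₂ * t ^ e
    second-term≤ = begin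
      2 ^ c * m ^ l₀ * ((c + m) C k)                      ≤⟨ *-mono-≤ (*-monoʳ-≤ (2 ^ c) (^-monoˡ-≤ l₀ m≤2Dt))
                                                               (≤-trans (C≤^ (c + m) k) (^-monoˡ-≤ k c+m≤D′t)) ⟩
      2 ^ c * (2 * D * t) ^ l₀ * (D′ * t) ^ k              ≡⟨ cong₂ (λ x y → 2 ^ c * x * y) (*-^-distrib (2 * D) t l₀)
                                                               (*-^-distrib D′ t k) ⟩
      2 ^ c * ((2 * D) ^ l₀ * t ^ l₀) * (D′ ^ k * t ^ k)  ≡⟨ rearrange (2 ^ c) ((2 * D) ^ l₀) (t ^ l₀) (D′ ^ k) (t ^ k) ⟩
      K₂ * (t ^ l₀ * t ^ k)                               ≡⟨ cong (K₂ *_) (^-distribˡ-+-* t l₀ k) ⟨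
      K₂ * t ^ e                                          ∎
      where
      open ≤-Reasoning
      rearrange : ∀ p a b c d → p * (a * b) * (c * d) ≡ p * a * c * (b * d)
      rearrange = solve-∀

    main-term≥ : t * t ^ e ≤ m * (m C l₀) * (m C k)
    main-term≥ = begin
      t * t ^ e                   ≡⟨ cong (t *_) (^-distribˡ-+-* t l₀ k) ⟩
      t * (t ^ l₀ * t ^ k)        ≡⟨ *-assoc t _ _ ⟨
      t * t ^ l₀ * t ^ k          ≤⟨ *-mono-≤ (*-mono-≤ t≤m (^≤C t l₀ (jt≤m (≤-trans (m≤m+n l₀ k) (n≤1+n e)))))
                                              (^≤C t k (jt≤m (≤-trans (m≤n+m k l₀) (n≤1+n e)))) ⟩
      m * (m C l₀) * (m C k)      ∎
      where
      open ≤-Reasoning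
      jt≤m : ∀ {j} → j ≤ D → j * t ≤ m
      jt≤m j≤D = ≤-trans (*-monoˡ-≤ t j≤D) Dt≤m
      t≤m : t ≤ m
      t≤m = ≤-trans (m≤n*m t D) Dt≤m

  estimate : ∀ m → threshold < m →
    m * ((c + m) C suc l₀) * (c C k) + 2 ^ c * m ^ l₀ * ((c + m) C k) < m * (m C l₀) * (m C k)
  estimate m threshold<m = begin-strict
    m * ((c + m) C suc l₀) * (c C k) + 2 ^ c * m ^ l₀ * ((c + m) C k)
                              ≤⟨ +-mono-≤ (first-term≤ 1≤t Dt≤m m≤2Dt) (second-term≤ 1≤t Dt≤m m≤2Dt) ⟩
    K₁ * t ^ e + K₂ * t ^ e   ≡⟨ *-distribʳ-+ (t ^ e) K₁ K₂ ⟨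
    K * t ^ e                 <⟨ *-monoˡ-< (t ^ e) {{m^n≢0 t e {{>-nonZero 1≤t}}}} K<t ⟩
    t * t ^ e                 ≤⟨ main-term≥ 1≤t Dt≤m m≤2Dt ⟩
    m * (m C l₀) * (m C k)    ∎
    where
    open ≤-Reasoning
    t = m / D
    m≡ρ+tD : m ≡ m % D + t * D
    m≡ρ+tD = m≡m%n+[m/n]*n m D
    K<t : K < t
    K<t = ≮⇒≥ (λ t<1+K → <-asym threshold<m (begin-strict
      m                 ≡⟨ m≡ρ+tD ⟩
      m % D + t * D     <⟨ +-monoˡ-< (t * D) (m%n<n m D) ⟩
      suc t * D         ≤⟨ *-monoˡ-≤ D t<1+K ⟩
      threshold         ∎))
    1≤t : 1 ≤ t
    1≤t = ≤-trans (s≤s z≤n) K<t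
    Dt≤m : D * t ≤ m
    Dt≤m = subst (D * t ≤_) (sym m≡ρ+tD) (subst (_≤ m % D + t * D) (*-comm t D) (m≤n+m (t * D) (m % D)))
    m≤2Dt : m ≤ 2 * D * t
    m≤2Dt = begin
      m                 ≡⟨ m≡ρ+tD ⟩
      m % D + t * D     ≤⟨ +-monoˡ-≤ (t * D) (<⇒≤ (m%n<n m D)) ⟩
      D + t * D         ≤⟨ +-monoˡ-≤ (t * D) (subst (_≤ t * D) (*-identityˡ D) (*-monoˡ-≤ D 1≤t)) ⟩
      t * D + t * D     ≡⟨ double t D ⟩
      2 * D * t         ∎
      where
      double : ∀ t d → t * d + t * d ≡ 2 * d * t
      double = solve-∀

-- The extremal family

meets : ∀ {n} → ℕ → Subset n → Bool
meets zero p = false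
meets (suc σ) [] = false
meets (suc σ) (b ∷ p) = b ∨ meets σ p

private
  any-tabulate-meets : ∀ {A : Set} {n} σ (p : Subset n) (f : A → Bool) (g : Fin n → A) →
                       (∀ i → f (g i) ≡ lookup p i ∧ (toℕ i <ᵇ σ)) → any f (List.tabulate g) ≡ meets σ p
  any-tabulate-meets σ [] f g _ with σ
  ... | zero = refl
  ... | suc _ = refl
  any-tabulate-meets zero (b ∷ p) f g f∘g rewrite f∘g fzero | any-tabulate-meets zero p f (g ∘ fsuc) (f∘g ∘ fsuc) with b
  ... | true = refl
  ... | false = refl
  any-tabulate-meets (suc σ) (b ∷ p) f g f∘g
    rewrite f∘g fzero | ∧-identityʳ b | any-tabulate-meets σ p f (g ∘ fsuc) (f∘g ∘ fsuc) = refl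

Extremal≡ : ∀ n σ r (e : Subset n) → Extremal n (suc σ) r e ≡ (∣ e ∣ ≡ᵇ r) ∧ meets σ e
Extremal≡ n σ r e = cong ((∣ e ∣ ≡ᵇ r) ∧_) (any-tabulate-meets σ e _ (λ i → i) (λ _ → refl))

meets-complete : ∀ σ {n} (p : Subset n) i → lookup p i ≡ true → toℕ i < σ → meets σ p ≡ true
meets-complete (suc σ) (true ∷ p) i _ _ = refl
meets-complete (suc σ) (false ∷ p) (fsuc i) pi (s≤s i<σ) = meets-complete σ p i pi i<σ

meets-sound : ∀ σ {n} (p : Subset n) → meets σ p ≡ true → ∃[ i ] (lookup p i ≡ true × toℕ i < σ)
meets-sound (suc σ) (true ∷ p) _ = fzero , refl , s≤s z≤n
meets-sound (suc σ) (false ∷ p) meets-p with meets-sound σ p meets-p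
... | i , pi , i<σ = fsuc i , pi , s≤s i<σ

meets-false : ∀ σ {n} (p : Subset n) i → meets σ p ≡ false → lookup p i ≡ true → σ ≤ toℕ i
meets-false σ p i misses pi = ≮⇒≥ (λ i<σ → false≢true (trans (sym misses) (meets-complete σ p i pi i<σ)))

meets-⊆ᵇ : ∀ σ {n} (p q : Subset n) → (p ⊆ᵇ q) ≡ true → meets σ p ≡ true → meets σ q ≡ true
meets-⊆ᵇ (suc σ) (true ∷ p) (true ∷ q) _ _ = refl
meets-⊆ᵇ (suc σ) (false ∷ p) (b ∷ q) p⊆q meets-p with b
... | true = refl
... | false = meets-⊆ᵇ σ p q p⊆q meets-p

meets-++ᵛ : ∀ σ {c m} (p : Subset c) (q : Subset m) → σ ≤ c → meets σ (p ++ᵛ q) ≡ meets σ p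
meets-++ᵛ zero p q _ = refl
meets-++ᵛ (suc σ) (b ∷ p) q (s≤s σ≤c) = cong (b ∨_) (meets-++ᵛ σ p q σ≤c)

module _ {n l : ℕ} where

  count-covers : ∀ (t : Subset n) → ∣ t ∣ ≡ l → count (λ e → (t ⊆ᵇ e) ∧ (∣ e ∣ ≡ᵇ suc l)) (allSubsets n) ≡ n ∸ l
  count-covers t ∣t∣≡l = begin
    count (λ e → (t ⊆ᵇ e) ∧ (∣ e ∣ ≡ᵇ suc l)) (allSubsets n)       ≡⟨ cong (λ j → count (λ e → (t ⊆ᵇ e) ∧ (∣ e ∣ ≡ᵇ j)) (allSubsets n)) 1+l≡ ⟩
    count (λ e → (t ⊆ᵇ e) ∧ (∣ e ∣ ≡ᵇ ∣ t ∣ + 1)) (allSubsets n) ≡⟨ count-supersets n t 1 ⟩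
    (n ∸ ∣ t ∣) C 1                                                 ≡⟨ nC1≡n (n ∸ ∣ t ∣) ⟩
    n ∸ ∣ t ∣                                                       ≡⟨ cong (n ∸_) ∣t∣≡l ⟩
    n ∸ l                                                           ∎
    where
    open ≡-Reasoning
    1+l≡ : suc l ≡ ∣ t ∣ + 1
    1+l≡ = trans (cong suc (sym ∣t∣≡l)) (+-comm 1 ∣ t ∣)

  degree≤n∸l : ∀ {H : Hypergraph n} → Uniform (suc l) H → ∀ t → ∣ t ∣ ≡ l → degree H t ≤ n ∸ l
  degree≤n∸l {H} uniform t ∣t∣≡l = ≤-trans (count-mono (allSubsets n) edge-covers) (≤-reflexive (count-covers t ∣t∣≡l))
    where
    edge-covers : ∀ e → H e ∧ (t ⊆ᵇ e) ≡ true → (t ⊆ᵇ e) ∧ (∣ e ∣ ≡ᵇ suc l) ≡ true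
    edge-covers e He∧t⊆e = ∧-intro (∧-conicalʳ (H e) _ He∧t⊆e)
      (subst (λ j → (j ≡ᵇ suc l) ≡ true) (sym (uniform e (∧-conicalˡ (H e) _ He∧t⊆e))) (≡ᵇ-refl (suc l)))

  module _ (σ : ℕ) where

    degree-Extremal : ∀ t → meets σ t ≡ true → ∣ t ∣ ≡ l → degree (Extremal n (suc σ) (suc l)) t ≡ n ∸ l
    degree-Extremal t t-meets ∣t∣≡l = trans (∑-cong (allSubsets n) same-edges) (count-covers t ∣t∣≡l)
      where
      same-edges : ∀ e → 𝟙 (Extremal n (suc σ) (suc l) e ∧ (t ⊆ᵇ e)) ≡ 𝟙 ((t ⊆ᵇ e) ∧ (∣ e ∣ ≡ᵇ suc l))
      same-edges e rewrite Extremal≡ n σ (suc l) e with t ⊆ᵇ e in t⊆e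
      ... | true rewrite meets-⊆ᵇ σ t e t⊆e t-meets = cong 𝟙 (trans (∧-identityʳ _) (∧-identityʳ _))
      ... | false rewrite ∧-zeroʳ ((∣ e ∣ ≡ᵇ suc l) ∧ meets σ e) = refl

    degree≤degree-Extremal : ∀ {H : Hypergraph n} → Uniform (suc l) H → ∀ t → meets σ t ≡ true → degree H t ≤ degree (Extremal n (suc σ) (suc l)) t
    degree≤degree-Extremal {H} uniform t t-meets = count-mono (allSubsets n) H⇒Ext
      where
      H⇒Ext : ∀ e → H e ∧ (t ⊆ᵇ e) ≡ true → Extremal n (suc σ) (suc l) e ∧ (t ⊆ᵇ e) ≡ true
      H⇒Ext e He∧t⊆e = ∧-intro (trans (Extremal≡ n σ (suc l) e)
          (∧-intro (subst (λ j → (j ≡ᵇ suc l) ≡ true) (sym (uniform e He)) (≡ᵇ-refl (suc l)))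
                   (meets-⊆ᵇ σ t e t⊆e t-meets)))
        t⊆e
        where
        He = ∧-conicalˡ (H e) _ He∧t⊆e
        t⊆e = ∧-conicalʳ (H e) _ He∧t⊆e

NoEdgeWithCore : ∀ {c m} → Hypergraph (c + m) → Subset c → Set
NoEdgeWithCore {m = m} H p = ∀ (q : Subset m) → H (p ++ᵛ q) ≡ true → ⊥

module _ {c m l} {H : Hypergraph (c + m)} (uniform : Uniform (suc l) H) (p : Subset c) (q : Subset m)
         (∣p++q∣≡l : ∣ p ++ᵛ q ∣ ≡ l) (no-edge : NoEdgeWithCore H p) where

  private
    -- An edge through p ∪ q adds one vertex, which must lie in the core since p itself is not the core part of an edge.
    edge-through : ∀ pe qe → H (pe ++ᵛ qe) ≡ true → ((p ++ᵛ q) ⊆ᵇ (pe ++ᵛ qe)) ≡ true →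
                   (p ⊆ᵇ pe) ≡ true × ∣ pe ∣ ≡ ∣ p ∣ + 1 × qe ≡ q
    edge-through pe qe He T⊆e = p⊆pe , ∣pe∣≡ , sym q≡qe
      where
      parts : (p ⊆ᵇ pe) ∧ (q ⊆ᵇ qe) ≡ true
      parts = trans (sym (⊆ᵇ-++ᵛ p pe q qe)) T⊆e
      p⊆pe = ∧-conicalˡ (p ⊆ᵇ pe) _ parts
      q⊆qe = ∧-conicalʳ (p ⊆ᵇ pe) _ parts
      sizes : ∣ pe ∣ + ∣ qe ∣ ≡ suc (∣ p ∣ + ∣ q ∣)
      sizes = trans (sym (∣++ᵛ∣ pe qe)) (trans (uniform _ He) (cong suc (trans (sym ∣p++q∣≡l) (∣++ᵛ∣ p q))))
      p<pe : ∣ p ∣ < ∣ pe ∣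
      p<pe = ≰⇒> (λ pe≤p → no-edge qe (subst (λ p′ → H (p′ ++ᵛ qe) ≡ true) (sym (⊆ᵇ∧∣≥∣⇒≡ p pe p⊆pe pe≤p)) He))
      q≡qe : q ≡ qe
      q≡qe = ⊆ᵇ∧∣≥∣⇒≡ q qe q⊆qe (+-cancelˡ-≤ (suc ∣ p ∣) _ _ (≤-trans (+-monoˡ-≤ ∣ qe ∣ p<pe) (≤-reflexive sizes)))
      ∣pe∣≡ : ∣ pe ∣ ≡ ∣ p ∣ + 1
      ∣pe∣≡ = trans (+-cancelʳ-≡ ∣ qe ∣ _ _ (trans sizes (cong (λ q′ → suc (∣ p ∣ + ∣ q′ ∣)) q≡qe))) (+-comm 1 ∣ p ∣)

    covering-edge≤ : ∀ pe qe → 𝟙 (H (pe ++ᵛ qe) ∧ ((p ++ᵛ q) ⊆ᵇ (pe ++ᵛ qe))) ≤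
                               (if qe ==ˢ q then 𝟙 ((p ⊆ᵇ pe) ∧ (∣ pe ∣ ≡ᵇ ∣ p ∣ + 1)) else 0)
    covering-edge≤ pe qe with H (pe ++ᵛ qe) in He | (p ++ᵛ q) ⊆ᵇ (pe ++ᵛ qe) in T⊆e
    ... | false | _ = z≤n
    ... | true | false = z≤n
    ... | true | true with edge-through pe qe He T⊆e
    ...   | p⊆pe , ∣pe∣≡ , refl rewrite ==ˢ-refl q | p⊆pe | ∣pe∣≡ | ≡ᵇ-refl (∣ p ∣ + 1) = ≤-refl

  degree≤core : degree H (p ++ᵛ q) ≤ c
  degree≤core = begin
    degree H (p ++ᵛ q)
      ≡⟨ ∑-allSubsets-++ᵛ c m _ ⟩
    ∑ (λ pe → ∑ (λ qe → 𝟙 (H (pe ++ᵛ qe) ∧ ((p ++ᵛ q) ⊆ᵇ (pe ++ᵛ qe)))) (allSubsets m)) (allSubsets c)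
      ≤⟨ ∑-mono-≤ (allSubsets c) (λ pe → ∑-mono-≤ (allSubsets m) (covering-edge≤ pe)) ⟩
    ∑ (λ pe → ∑ (λ qe → if qe ==ˢ q then 𝟙 ((p ⊆ᵇ pe) ∧ (∣ pe ∣ ≡ᵇ ∣ p ∣ + 1)) else 0) (allSubsets m)) (allSubsets c)
      ≡⟨ ∑-cong (allSubsets c) (λ pe → ∑-allSubsets-δ m q (λ _ → 𝟙 ((p ⊆ᵇ pe) ∧ (∣ pe ∣ ≡ᵇ ∣ p ∣ + 1)))) ⟩
    count (λ pe → (p ⊆ᵇ pe) ∧ (∣ pe ∣ ≡ᵇ ∣ p ∣ + 1)) (allSubsets c)
      ≡⟨ count-supersets c p 1 ⟩
    (c ∸ ∣ p ∣) C 1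
      ≡⟨ nC1≡n (c ∸ ∣ p ∣) ⟩
    c ∸ ∣ p ∣
      ≤⟨ m∸n≤m c ∣ p ∣ ⟩
    c ∎
    where open ≤-Reasoning

Extremal-uniform : ∀ n σ r → Uniform r (Extremal n (suc σ) r)
Extremal-uniform n σ r e e∈ = ≡ᵇ-sound (∧-conicalˡ (∣ e ∣ ≡ᵇ r) _ (trans (sym (Extremal≡ n σ r e)) e∈))

private
  ∣remove∣ : ∀ {n} (e : Subset n) x → lookup e x ≡ true → suc ∣ e [ x ]≔ false ∣ ≡ ∣ e ∣
  ∣remove∣ e x ex = trans (+-comm 1 _) (trans (subst (λ b → ∣ e [ x ]≔ false ∣ + 𝟙 b ≡ ∣ e ∣ + 0) ex (∣∣-update e x false))
                                               (+-identityʳ ∣ e ∣))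

  nonempty-witness : ∀ {n} (e : Subset n) {j} → ∣ e ∣ ≡ suc j → ∃[ x ] (lookup e x ≡ true)
  nonempty-witness (true ∷ e) _ = fzero , refl
  nonempty-witness (false ∷ e) ∣e∣ with nonempty-witness e ∣e∣
  ... | x , ex = fsuc x , ex

  remove-⊆ᵇ : ∀ {n} (e : Subset n) x → ((e [ x ]≔ false) ⊆ᵇ e) ≡ true
  remove-⊆ᵇ (b ∷ e) fzero = ⊆ᵇ-refl e
  remove-⊆ᵇ (true ∷ e) (fsuc x) = remove-⊆ᵇ e x
  remove-⊆ᵇ (false ∷ e) (fsuc x) = remove-⊆ᵇ e x

Extremal-kernel : ∀ n σ l₀ e → Extremal n (suc σ) (suc (suc l₀)) e ≡ true →
                  ∃[ t ] ((t ⊆ᵇ e) ≡ true × ∣ t ∣ ≡ suc l₀ × meets σ t ≡ true)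
Extremal-kernel n σ l₀ e e∈ with meets-sound σ e (∧-conicalʳ (∣ e ∣ ≡ᵇ suc (suc l₀)) _ (trans (sym (Extremal≡ n σ _ e)) e∈))
... | i , ei , i<σ with nonempty-witness (e [ i ]≔ false) (suc-injective (trans (∣remove∣ e i ei) ∣e∣))
  where ∣e∣ = Extremal-uniform n σ (suc (suc l₀)) e e∈
... | x , e₁x = e [ x ]≔ false , remove-⊆ᵇ e x , suc-injective (trans (∣remove∣ e x ex) ∣e∣) ,
                meets-complete σ _ i (trans (lookup∘update′ i≢x e false) ei) i<σ
  where
  ∣e∣ = Extremal-uniform n σ (suc (suc l₀)) e e∈
  x≢i : x ≢ i
  x≢i refl = false≢true (trans (sym (lookup∘update i e false)) e₁x)
  i≢x : i ≢ x
  i≢x = x≢i ∘ sym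
  ex : lookup e x ≡ true
  ex = trans (sym (lookup∘update′ x≢i e false)) e₁x

-- Comparison with the extremal family when the ground set is a core [c] followed by m further vertices.
-- Positions are 0-based: σ = s − 1, so [s − 1] is [0, σ) and its last vertex is τ = σ₀; l = r − 1.

module Comparison {σ₀ l₀ m : ℕ} {H : Hypergraph (coreSize (suc σ₀) (suc l₀) + m)}
            (uniform : Uniform (suc (suc l₀)) H) (shifted : Shifted H) (ν<s : νLessThan H (suc (suc σ₀))) where

  σ l c n : ℕ
  σ = suc σ₀
  l = suc l₀
  c = coreSize σ l
  n = c + m

  Ext : Hypergraph n
  Ext = Extremal n (suc σ) (suc l)

  ∑∑ : (Subset c → Subset m → ℕ) → ℕ
  ∑∑ f = ∑ (λ p → ∑ (f p) (allSubsets m)) (allSubsets c)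

  ∑∑-distrib-+ : ∀ (f g : Subset c → Subset m → ℕ) → ∑∑ (λ p q → f p q + g p q) ≡ ∑∑ f + ∑∑ g
  ∑∑-distrib-+ f g = trans (∑-cong (allSubsets c) (λ p → ∑-distrib-+ (f p) (g p) (allSubsets m)))
                           (∑-distrib-+ (λ p → ∑ (f p) (allSubsets m)) (λ p → ∑ (g p) (allSubsets m)) (allSubsets c))

  ∑∑-mono-≤ : ∀ {f g : Subset c → Subset m → ℕ} → (∀ p q → f p q ≤ g p q) → ∑∑ f ≤ ∑∑ g
  ∑∑-mono-≤ f≤g = ∑-mono-≤ (allSubsets c) (λ p → ∑-mono-≤ (allSubsets m) (f≤g p))

  ∑∑-distribʳ-* : ∀ (f : Subset c → Subset m → ℕ) x → ∑∑ (λ p q → f p q * x) ≡ ∑∑ f * x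
  ∑∑-distribʳ-* f x = trans (∑-cong (allSubsets c) (λ p → ∑-distribʳ-* (f p) x (allSubsets m)))
                            (∑-distribʳ-* (λ p → ∑ (f p) (allSubsets m)) x (allSubsets c))

  σ≤c : σ ≤ c
  σ≤c = ≤-trans (n≤1+n σ) (≤-trans (m≤m+n (suc σ) (suc σ * l)) (m≤m+n _ (suc σ * l)))

  m≤n∸l : m ≤ n ∸ l
  m≤n∸l = m+n≤o⇒m≤o∸n m (subst (m + l ≤_) (+-comm m c) (+-monoʳ-≤ m l≤c))
    where
    l≤c : l ≤ c
    l≤c = ≤-trans (m≤m+n l (σ * l)) (m≤n+m (suc σ * l) (suc σ + suc σ * l))

  lookup-core : ∀ (p : Subset c) (q : Subset m) v → lookup (p ++ᵛ q) v ≡ true → (v<c : toℕ v < c) →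
                lookup p (fromℕ< v<c) ≡ true
  lookup-core p q v v∈ v<c = trans (sym (lookup-++-< p q v v<c)) v∈

  ⁅τ⁆ : Subset c
  ⁅τ⁆ = ⟦ _≡ᵇ σ₀ ⟧

  no-edge-with-core-⁅τ⁆ : ∀ {e₀} → H e₀ ≡ true → meets σ e₀ ≡ false → NoEdgeWithCore H ⁅τ⁆
  no-edge-with-core-⁅τ⁆ {e₀} He₀ e₀-misses q He = ν<s (twoEdges⇒disjointEdges shifted (m≤m+n c m)
      He₀ (uniform e₀ He₀) (λ v e₀v → meets-false σ e₀ v e₀-misses e₀v)
      He (uniform _ He) only-τ)
    where
    only-τ : ∀ v → lookup (⁅τ⁆ ++ᵛ q) v ≡ true → toℕ v < c → toℕ v ≡ σ₀
    only-τ v v∈ v<c = trans (sym (toℕ-fromℕ< v<c))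
      (≡ᵇ-sound (trans (sym (lookup-⟦⟧ (_≡ᵇ σ₀) (fromℕ< v<c))) (lookup-core ⁅τ⁆ q v v∈ v<c)))

  no-edge-with-sparse-core : ∀ (p : Subset c) → meets σ p ≡ false → ∣ p ∣ ≤ 1 → NoEdgeWithCore H p
  no-edge-with-sparse-core p p-misses ∣p∣≤1 q He = ν<s (sparseEdge⇒disjointEdges shifted (m≤m+n c m)
      He (uniform _ He) above-σ at-most-one)
    where
    above-σ : ∀ v → lookup (p ++ᵛ q) v ≡ true → σ ≤ toℕ v
    above-σ v v∈ = meets-false σ (p ++ᵛ q) v (trans (meets-++ᵛ σ p q σ≤c) p-misses) v∈
    at-most-one : ∀ v w → lookup (p ++ᵛ q) v ≡ true → lookup (p ++ᵛ q) w ≡ true → toℕ v < c → toℕ w < c → v ≡ w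
    at-most-one v w v∈ w∈ v<c w<c = toℕ-injective (trans (sym (toℕ-fromℕ< v<c)) (trans
      (cong toℕ (∣p∣≤1⇒unique p ∣p∣≤1 _ _ (lookup-core p q v v∈ v<c) (lookup-core p q w w∈ w<c))) (toℕ-fromℕ< w<c)))

  ⁅τ⁆-meets : meets σ ⁅τ⁆ ≡ true
  ⁅τ⁆-meets = meets-complete σ ⁅τ⁆ τ
    (trans (lookup-⟦⟧ (_≡ᵇ σ₀) τ) (subst (λ v → (v ≡ᵇ σ₀) ≡ true) (sym toℕ-τ) (≡ᵇ-refl σ₀)))
    (subst (_< σ) (sym toℕ-τ) ≤-refl)
    where
    τ = fromℕ< {σ₀} {c} σ≤c
    toℕ-τ = toℕ-fromℕ< {σ₀} {c} σ≤c

  module _ (k : ℕ) (2≤k : 2 ≤ k) {e₀ : Subset n} (He₀ : H e₀ ≡ true) (e₀-misses : meets σ e₀ ≡ false) where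

    Φ : ℕ
    Φ = (n ∸ l) C k

    -- A kernel {τ} ∪ q has H-degree at most c but Ext-degree n − l, so H loses stars there; any other kernel has at
    -- most C(c, k) more H-stars than Ext-stars, or C(n, k) if it has at least two core vertices.
    loss allowance : Subset c → Subset m → ℕ
    loss p q = if (∣ p ++ᵛ q ∣ ≡ᵇ l) ∧ (p ==ˢ ⁅τ⁆) then Φ else 0
    allowance p q = 𝟙 (∣ p ++ᵛ q ∣ ≡ᵇ l) * (c C k) + 𝟙 ((∣ p ++ᵛ q ∣ ≡ᵇ l) ∧ (2 ≤ᵇ ∣ p ∣)) * (n C k)

    private
      into-allowanceˡ : ∀ {a u} z v → a ≤ u → a + 0 ≤ z + (u + v)
      into-allowanceˡ {a} {u} z v a≤u = ≤-trans (≤-reflexive (+-identityʳ a)) (≤-trans (≤-trans a≤u (m≤m+n u v)) (m≤n+m (u + v) z))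

      into-allowanceʳ : ∀ {a v} z u → a ≤ v → a + 0 ≤ z + (u + v)
      into-allowanceʳ {a} {v} z u a≤v = ≤-trans (≤-reflexive (+-identityʳ a)) (≤-trans (≤-trans a≤v (m≤n+m v u)) (m≤n+m (u + v) z))

    ⁅τ⁆-kernel≤ : ∀ p q → p ≡ ⁅τ⁆ → ∣ p ++ᵛ q ∣ ≡ l → ∀ b →
                  degree H (p ++ᵛ q) C k + Φ ≤ degree Ext (p ++ᵛ q) C k + (1 * (c C k) + 𝟙 b * (n C k))
    ⁅τ⁆-kernel≤ p q refl ∣T∣≡l b = begin
      degree H T C k + Φ                                ≤⟨ +-monoˡ-≤ Φ (C-monoˡ-≤ k (degree≤core uniform ⁅τ⁆ q ∣T∣≡l
                                                             (no-edge-with-core-⁅τ⁆ He₀ e₀-misses))) ⟩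
      c C k + Φ                                         ≡⟨ +-comm (c C k) Φ ⟩
      Φ + c C k                                         ≤⟨ +-monoʳ-≤ Φ (≤-trans (≤-reflexive (sym (*-identityˡ (c C k)))) (m≤m+n _ _)) ⟩
      Φ + (1 * (c C k) + 𝟙 b * (n C k))                 ≡⟨ cong (λ d → d C k + (1 * (c C k) + 𝟙 b * (n C k)))
                                                             (degree-Extremal σ T (trans (meets-++ᵛ σ ⁅τ⁆ q σ≤c) ⁅τ⁆-meets) ∣T∣≡l) ⟨
      degree Ext T C k + (1 * (c C k) + 𝟙 b * (n C k))  ∎
      where
      open ≤-Reasoning
      T = ⁅τ⁆ ++ᵛ q

    starsAt+loss≤ : ∀ p q → starsAt k (suc l) H (p ++ᵛ q) + loss p q ≤ starsAt k (suc l) Ext (p ++ᵛ q) + allowance p q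
    starsAt+loss≤ p q with ∣ p ++ᵛ q ∣ ≡ᵇ l in ∣T∣≡l | meets σ p in p-meets | p ==ˢ ⁅τ⁆ in p≡⁅τ⁆ | 2 ≤ᵇ ∣ p ∣ in 2≤∣p∣
    ... | false | _ | _ | _ = z≤n
    ... | true | true | true | b = ⁅τ⁆-kernel≤ p q (==ˢ⇒≡ p ⁅τ⁆ p≡⁅τ⁆) (≡ᵇ-sound ∣T∣≡l) b
    ... | true | true | false | b =
      ≤-trans (≤-reflexive (+-identityʳ _))
        (≤-trans (C-monoˡ-≤ k (degree≤degree-Extremal σ uniform (p ++ᵛ q) (trans (meets-++ᵛ σ p q σ≤c) p-meets))) (m≤m+n _ _))
    ... | true | false | true | _ =
      ⊥-elim (false≢true (trans (sym p-meets) (subst (λ p′ → meets σ p′ ≡ true) (sym (==ˢ⇒≡ p ⁅τ⁆ p≡⁅τ⁆)) ⁅τ⁆-meets)))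
    ... | true | false | false | true =
      into-allowanceʳ (degree Ext (p ++ᵛ q) C k) (1 * (c C k))
        (≤-trans (C-monoˡ-≤ k (≤-trans (degree≤n∸l uniform (p ++ᵛ q) (≡ᵇ-sound ∣T∣≡l)) (m∸n≤m n l)))
                 (≤-reflexive (sym (*-identityˡ (n C k)))))
    ... | true | false | false | false =
      into-allowanceˡ (degree Ext (p ++ᵛ q) C k) (0 * (n C k))
        (≤-trans (C-monoˡ-≤ k (degree≤core uniform p q (≡ᵇ-sound ∣T∣≡l) (no-edge-with-sparse-core p p-meets ∣p∣≤1)))
                 (≤-reflexive (sym (*-identityˡ (c C k)))))
      where
      ∣p∣≤1 : ∣ p ∣ ≤ 1
      ∣p∣≤1 = m<1+n⇒m≤n (≰⇒> (λ 2≤p → false≢true (trans (sym 2≤∣p∣) (≤ᵇ-complete 2≤p))))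

    private
      ∑-if : ∀ {A : Set} b (f : A → ℕ) xs → ∑ (λ x → if b then f x else 0) xs ≡ (if b then ∑ f xs else 0)
      ∑-if true f xs = refl
      ∑-if false f xs = ∑-zero xs (λ _ → refl)

      loss-row : ∀ p → ∑ (loss p) (allSubsets m) ≡ (if p ==ˢ ⁅τ⁆ then ∑ (λ q → 𝟙 (∣ p ++ᵛ q ∣ ≡ᵇ l) * Φ) (allSubsets m) else 0)
      loss-row p = trans (∑-cong (allSubsets m) pointwise) (∑-if (p ==ˢ ⁅τ⁆) (λ q → 𝟙 (∣ p ++ᵛ q ∣ ≡ᵇ l) * Φ) (allSubsets m))
        where
        pointwise : ∀ q → loss p q ≡ (if p ==ˢ ⁅τ⁆ then 𝟙 (∣ p ++ᵛ q ∣ ≡ᵇ l) * Φ else 0)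
        pointwise q with ∣ p ++ᵛ q ∣ ≡ᵇ l | p ==ˢ ⁅τ⁆
        ... | true | true = sym (+-identityʳ Φ)
        ... | true | false = refl
        ... | false | true = refl
        ... | false | false = refl

    ∑∑-loss : ∑∑ loss ≡ (m C l₀) * Φ
    ∑∑-loss = begin
      ∑∑ loss                                                                   ≡⟨ ∑-cong (allSubsets c) loss-row ⟩
      ∑ (λ p → if p ==ˢ ⁅τ⁆ then ∑ (λ q → 𝟙 (∣ p ++ᵛ q ∣ ≡ᵇ l) * Φ) (allSubsets m) else 0) (allSubsets c)
                                                                                ≡⟨ ∑-allSubsets-δ c ⁅τ⁆ _ ⟩
      ∑ (λ q → 𝟙 (∣ ⁅τ⁆ ++ᵛ q ∣ ≡ᵇ l) * Φ) (allSubsets m)                       ≡⟨ ∑-distribʳ-* _ Φ (allSubsets m) ⟩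
      count (λ q → ∣ ⁅τ⁆ ++ᵛ q ∣ ≡ᵇ l) (allSubsets m) * Φ                         ≡⟨ cong (_* Φ) (∑-cong (allSubsets m) ∣⁅τ⁆++q∣) ⟩
      count (λ q → ∣ q ∣ ≡ᵇ l₀) (allSubsets m) * Φ                                ≡⟨ cong (_* Φ) (count-allSubsets-∣∣≡ m l₀) ⟩
      (m C l₀) * Φ                                                              ∎
      where
      open ≡-Reasoning
      ∣⁅τ⁆++q∣ : ∀ q → 𝟙 (∣ ⁅τ⁆ ++ᵛ q ∣ ≡ᵇ l) ≡ 𝟙 (∣ q ∣ ≡ᵇ l₀)
      ∣⁅τ⁆++q∣ q rewrite ∣++ᵛ∣ ⁅τ⁆ q | ∣⟦⟧∣ c (_≡ᵇ σ₀) | countℕ-point c σ₀ σ≤c = refl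

    wideKernels : ℕ
    wideKernels = ∑∑ (λ p q → 𝟙 ((∣ p ++ᵛ q ∣ ≡ᵇ l) ∧ (2 ≤ᵇ ∣ p ∣)))

    ∑∑-allowance : ∑∑ allowance ≡ (n C l) * (c C k) + wideKernels * (n C k)
    ∑∑-allowance = begin
      ∑∑ allowance
        ≡⟨ ∑-cong (allSubsets c) (λ p → ∑-distrib-+ (λ q → 𝟙 (∣ p ++ᵛ q ∣ ≡ᵇ l) * (c C k)) _ (allSubsets m)) ⟩
      ∑ (λ p → ∑ (λ q → 𝟙 (∣ p ++ᵛ q ∣ ≡ᵇ l) * (c C k)) (allSubsets m) + ∑ (λ q → 𝟙 ((∣ p ++ᵛ q ∣ ≡ᵇ l) ∧ (2 ≤ᵇ ∣ p ∣)) * (n C k)) (allSubsets m)) (allSubsets c)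
        ≡⟨ ∑-distrib-+ _ _ (allSubsets c) ⟩
      ∑∑ (λ p q → 𝟙 (∣ p ++ᵛ q ∣ ≡ᵇ l) * (c C k)) + ∑∑ (λ p q → 𝟙 ((∣ p ++ᵛ q ∣ ≡ᵇ l) ∧ (2 ≤ᵇ ∣ p ∣)) * (n C k))
        ≡⟨ cong₂ _+_ (∑∑-distribʳ-* (λ p q → 𝟙 (∣ p ++ᵛ q ∣ ≡ᵇ l)) (c C k)) (∑∑-distribʳ-* _ (n C k)) ⟩
      ∑∑ (λ p q → 𝟙 (∣ p ++ᵛ q ∣ ≡ᵇ l)) * (c C k) + wideKernels * (n C k)
        ≡⟨ cong (λ x → x * (c C k) + wideKernels * (n C k)) (trans (sym (∑-allSubsets-++ᵛ c m (λ t → 𝟙 (∣ t ∣ ≡ᵇ l)))) (count-allSubsets-∣∣≡ n l)) ⟩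
      (n C l) * (c C k) + wideKernels * (n C k)
        ∎
      where open ≡-Reasoning

    private
      ≡ᵇ-cong : ∀ {a b a′ b′} → (a ≡ b → a′ ≡ b′) → (a′ ≡ b′ → a ≡ b) → (a ≡ᵇ b) ≡ (a′ ≡ᵇ b′)
      ≡ᵇ-cong {a} {b} {a′} {b′} to from = ⇔→≡ {z = true} (mk⇔ (≡ᵇ-complete ∘ to ∘ ≡ᵇ-sound) (≡ᵇ-complete ∘ from ∘ ≡ᵇ-sound))
        where
        ≡ᵇ-complete : ∀ {x y} → x ≡ y → (x ≡ᵇ y) ≡ true
        ≡ᵇ-complete {x} refl = ≡ᵇ-refl x

      1+[1+l₀∸p]≤l₀ : ∀ {p} → 2 ≤ p → p ≤ suc l₀ → suc (suc l₀ ∸ p) ≤ l₀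
      1+[1+l₀∸p]≤l₀ {suc zero} (s≤s ()) _
      1+[1+l₀∸p]≤l₀ {suc (suc j)} _ (s≤s 1+j≤l₀) = ≤-trans (≤-reflexive (sym (+-∸-assoc 1 1+j≤l₀))) (m∸n≤m l₀ j)

      B-row : 1 ≤ m → ∀ (p : Subset c) → ∑ (λ q → 𝟙 ((∣ p ++ᵛ q ∣ ≡ᵇ l) ∧ (2 ≤ᵇ ∣ p ∣))) (allSubsets m) * m ≤ m ^ l₀
      B-row 1≤m p with 2 ≤ᵇ ∣ p ∣ in 2≤∣p∣ | ∣ p ∣ ≤? l
      ... | false | _ = ≤-trans (≤-reflexive (cong (_* m) (∑-zero (allSubsets m) (λ q → cong 𝟙 (∧-zeroʳ _))))) z≤n
      ... | true | no ∣p∣≰l = ≤-trans (≤-reflexive (cong (_* m) (∑-zero (allSubsets m) too-large))) z≤n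
        where
        too-large : ∀ q → 𝟙 ((∣ p ++ᵛ q ∣ ≡ᵇ l) ∧ true) ≡ 0
        too-large q rewrite ∧-identityʳ (∣ p ++ᵛ q ∣ ≡ᵇ l) | ∣++ᵛ∣ p q =
          cong 𝟙 (≡ᵇ-false (λ eq → ∣p∣≰l (subst (∣ p ∣ ≤_) eq (m≤m+n ∣ p ∣ ∣ q ∣))))
      ... | true | yes ∣p∣≤l = begin
        ∑ (λ q → 𝟙 ((∣ p ++ᵛ q ∣ ≡ᵇ l) ∧ true)) (allSubsets m) * m   ≡⟨ cong (_* m) (∑-cong (allSubsets m) shift) ⟩
        count (λ q → ∣ q ∣ ≡ᵇ l ∸ ∣ p ∣) (allSubsets m) * m          ≡⟨ cong (_* m) (count-allSubsets-∣∣≡ m (l ∸ ∣ p ∣)) ⟩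
        (m C (l ∸ ∣ p ∣)) * m                                       ≤⟨ *-monoˡ-≤ m (C≤^ m (l ∸ ∣ p ∣)) ⟩
        m ^ (l ∸ ∣ p ∣) * m                                         ≡⟨ *-comm (m ^ (l ∸ ∣ p ∣)) m ⟩
        m ^ suc (l ∸ ∣ p ∣)                                         ≤⟨ ^-monoʳ-≤ m {{>-nonZero 1≤m}} (1+[1+l₀∸p]≤l₀ (≤ᵇ-sound 2≤∣p∣) ∣p∣≤l) ⟩
        m ^ l₀                                                      ∎
        where
        open ≤-Reasoning
        shift : ∀ q → 𝟙 ((∣ p ++ᵛ q ∣ ≡ᵇ l) ∧ true) ≡ 𝟙 (∣ q ∣ ≡ᵇ l ∸ ∣ p ∣)
        shift q rewrite ∧-identityʳ (∣ p ++ᵛ q ∣ ≡ᵇ l) | ∣++ᵛ∣ p q =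
          cong 𝟙 (≡ᵇ-cong (λ eq → trans (sym (m+n∸m≡n ∣ p ∣ ∣ q ∣)) (cong (_∸ ∣ p ∣) eq))
                          (λ eq → trans (cong (∣ p ∣ +_) eq) (m+[n∸m]≡n ∣p∣≤l)))

    m*wideKernels≤ : 1 ≤ m → m * wideKernels ≤ 2 ^ c * m ^ l₀
    m*wideKernels≤ 1≤m = begin
      m * wideKernels                                                ≡⟨ *-comm m wideKernels ⟩
      wideKernels * m                                                ≡⟨ ∑-distribʳ-* (λ p → ∑ _ (allSubsets m)) m (allSubsets c) ⟨
      ∑ (λ p → ∑ _ (allSubsets m) * m) (allSubsets c)      ≤⟨ ∑-mono-≤ (allSubsets c) (B-row 1≤m) ⟩
      ∑ (λ _ → m ^ l₀) (allSubsets c)                      ≡⟨ ∑-allSubsets-const c (m ^ l₀) ⟩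
      2 ^ c * m ^ l₀                                       ∎
      where open ≤-Reasoning

    open BinomialEstimate c l₀ k 2≤k using (threshold; estimate)

    ∑∑-allowance<∑∑-loss : threshold < m → ∑∑ allowance < ∑∑ loss
    ∑∑-allowance<∑∑-loss threshold<m = *-cancelˡ-< m _ _ (begin-strict
      m * ∑∑ allowance                                      ≡⟨ cong (m *_) ∑∑-allowance ⟩
      m * ((n C l) * (c C k) + wideKernels * (n C k))                 ≡⟨ distrib m (n C l) (c C k) wideKernels (n C k) ⟩
      m * (n C l) * (c C k) + m * wideKernels * (n C k)               ≤⟨ +-monoʳ-≤ (m * (n C l) * (c C k)) (*-monoˡ-≤ (n C k) (m*wideKernels≤ 1≤m)) ⟩
      m * (n C l) * (c C k) + 2 ^ c * m ^ l₀ * (n C k)      <⟨ estimate m threshold<m ⟩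
      m * (m C l₀) * (m C k)                                ≤⟨ *-monoʳ-≤ (m * (m C l₀)) (C-monoˡ-≤ k m≤n∸l) ⟩
      m * (m C l₀) * Φ                                      ≡⟨ *-assoc m (m C l₀) Φ ⟩
      m * ((m C l₀) * Φ)                                    ≡⟨ cong (m *_) ∑∑-loss ⟨
      m * ∑∑ loss                                           ∎)
      where
      open ≤-Reasoning
      1≤m : 1 ≤ m
      1≤m = ≤-trans (s≤s z≤n) threshold<m
      distrib : ∀ a b c d e → a * (b * c + d * e) ≡ a * b * c + a * d * e
      distrib = solve-∀

    NStar<NStar-Extremal : threshold < m → NStar k (suc l) H < NStar k (suc l) Ext
    NStar<NStar-Extremal threshold<m =
      subst₂ _<_ (sym (NStar≡∑starsAt k (suc l) H 2≤k (s≤s z≤n) uniform))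
                 (sym (NStar≡∑starsAt k (suc l) Ext 2≤k (s≤s z≤n) (Extremal-uniform n σ (suc l))))
        (+-cancelʳ-< (∑∑ loss) _ _ (begin-strict
          ∑ (starsAt k (suc l) H) (allSubsets n) + ∑∑ loss             ≡⟨ cong (_+ ∑∑ loss) (∑-allSubsets-++ᵛ c m _) ⟩
          ∑∑ (λ p q → starsAt k (suc l) H (p ++ᵛ q)) + ∑∑ loss         ≡⟨ ∑∑-distrib-+ _ loss ⟨
          ∑∑ (λ p q → starsAt k (suc l) H (p ++ᵛ q) + loss p q)        ≤⟨ ∑∑-mono-≤ starsAt+loss≤ ⟩
          ∑∑ (λ p q → starsAt k (suc l) Ext (p ++ᵛ q) + allowance p q) ≡⟨ ∑∑-distrib-+ _ allowance ⟩
          ∑∑ (λ p q → starsAt k (suc l) Ext (p ++ᵛ q)) + ∑∑ allowance  ≡⟨ cong (_+ ∑∑ allowance) (∑-allSubsets-++ᵛ c m _) ⟨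
          ∑ (starsAt k (suc l) Ext) (allSubsets n) + ∑∑ allowance      <⟨ +-monoʳ-< _ (∑∑-allowance<∑∑-loss threshold<m) ⟩
          ∑ (starsAt k (suc l) Ext) (allSubsets n) + ∑∑ loss           ∎))
      where open ≤-Reasoning

  module _ (k : ℕ) (2≤k : 2 ≤ k) where

    open BinomialEstimate c l₀ k 2≤k using (threshold)

    NStar-≤-≡⇔≐ : threshold + k < m →
      (NStar k (suc l) H ≤ NStar k (suc l) Ext) × ((NStar k (suc l) H ≡ NStar k (suc l) Ext) ⇔ (H ≐ Ext))
    NStar-≤-≡⇔≐ large-m with anySubset? (λ e → (H e Bool.≟ true) ×-dec (Ext e Bool.≟ false))
    ... | yes (e₀ , He₀ , e₀∉Ext) =
      <⇒≤ H<Ext , mk⇔ (λ eq → ⊥-elim (<-irrefl eq H<Ext)) (NStar-cong k (suc l))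
      where
      e₀-misses : meets σ e₀ ≡ false
      e₀-misses = ¬-not (λ e₀-meets → false≢true (trans (sym e₀∉Ext)
                    (trans (Extremal≡ n σ (suc l) e₀) (∧-intro (subst (λ j → (j ≡ᵇ suc l) ≡ true) (sym (uniform e₀ He₀)) (≡ᵇ-refl (suc l))) e₀-meets))))
      H<Ext = NStar<NStar-Extremal k 2≤k He₀ e₀-misses (≤-trans (s≤s (m≤m+n threshold k)) large-m)
    ... | no H⊈Ext = NStar-mono-≤ k (suc l) H⊆Ext 2≤k (s≤s z≤n) Ext-uniform , mk⇔ ≡⇒≐ (NStar-cong k (suc l))
      where
      Ext-uniform = Extremal-uniform n σ (suc l)
      H⊆Ext : ∀ e → H e ≡ true → Ext e ≡ true
      H⊆Ext e He = ¬-not (λ e∉Ext → H⊈Ext (e , He , e∉Ext)) 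
      ≡⇒≐ : NStar k (suc l) H ≡ NStar k (suc l) Ext → H ≐ Ext
      ≡⇒≐ eq e with H e in He | Ext e in Exte
      ... | true | true = refl
      ... | false | false = refl
      ... | true | false = ⊥-elim (false≢true (trans (sym Exte) (H⊆Ext e He)))
      ... | false | true with Extremal-kernel n σ l₀ e Exte
      ...   | t , t⊆e , ∣t∣ , t-meets = ⊥-elim (<-irrefl eq
                (NStar-mono-< k (suc l) H⊆Ext 2≤k (s≤s z≤n) Ext-uniform {t = t} Exte He t⊆e ∣t∣ k≤degree))
        where
        k≤degree : k ≤ degree Ext t
        k≤degree = subst (k ≤_) (sym (degree-Extremal σ t t-meets ∣t∣))
                     (≤-trans (≤-trans (m≤n+m k threshold) (<⇒≤ large-m)) m≤n∸l)

νLessThan1⇒≐Extremal : ∀ {n} r (H : Hypergraph n) → νLessThan H 1 → H ≐ Extremal n 1 r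
νLessThan1⇒≐Extremal {n} r H ν<1 e = trans no-edge (sym (trans (Extremal≡ n 0 r e) (∧-zeroʳ (∣ e ∣ ≡ᵇ r))))
  where
  no-edge : H e ≡ false
  no-edge = ¬-not (λ He → ν<1 ((λ _ → e) , (λ _ → He) , λ { fzero fzero 0≢0 → ⊥-elim (0≢0 refl) }))

theorem3p2 : (s k r : ℕ) → 1 ≤ s → 2 ≤ k → 2 ≤ r →
    ∃[ n₀ ] ((n : ℕ) → n₀ < n → (H : Hypergraph n) →
    Uniform r H → Shifted H → νLessThan H s →
    (NStar k r H ≤ NStar k r (Extremal n s r))
    × ((NStar k r H ≡ NStar k r (Extremal n s r)) ⇔ (H ≐ Extremal n s r)))
theorem3p2 (suc zero) k r _ _ _ = 0 , λ n _ H _ _ ν<1 →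
  let H≐Ext = νLessThan1⇒≐Extremal r H ν<1 in
  ≤-reflexive (NStar-cong k r H≐Ext) , mk⇔ (λ _ → H≐Ext) (λ _ → NStar-cong k r H≐Ext)
theorem3p2 (suc (suc σ₀)) k (suc zero) _ _ (s≤s ())
theorem3p2 s@(suc (suc σ₀)) k r@(suc (suc l₀)) _ 2≤k _ = c + (threshold + k) , large-n
  where
  c = coreSize (suc σ₀) (suc l₀)
  open BinomialEstimate c l₀ k 2≤k using (threshold)
  Conclusion : ℕ → Set
  Conclusion n = (H : Hypergraph n) → Uniform r H → Shifted H → νLessThan H s →
    (NStar k r H ≤ NStar k r (Extremal n s r)) × ((NStar k r H ≡ NStar k r (Extremal n s r)) ⇔ (H ≐ Extremal n s r))
  large-n : ∀ n → c + (threshold + k) < n → Conclusion n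
  large-n n c+t<n = subst Conclusion (m+[n∸m]≡n c≤n)
    (λ H uniform shifted ν<s → Comparison.NStar-≤-≡⇔≐ uniform shifted ν<s k 2≤k (+-cancelˡ-< c _ _ (subst (_ <_) (sym (m+[n∸m]≡n c≤n)) c+t<n)))
    where
    c≤n : c ≤ n
    c≤n = ≤-trans (m≤m+n c _) (<⇒≤ c+t<n)
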